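{- For a finite simple graph $G=(V,E)$ define $$P(G,x)=\frac{1}{2^{|V|}}Z_G(2x,-2)=\frac{1}{2^{|V|}}\sum_{A\subseteq E}(2x)^{k(A)}(-2)^{|A|},$$ which equals $(-1)^{|V|-k(G)}x^{k(G)}T(G,1-x,-1)$, where $T$ is the Tutte polynomial. Then for every simple graph $G$ and every edge $e\in E(G)$, $$P(G,x)=P(G-e,x)-P(G\Delta e,x),$$ and $P(\overline{K_n},x)=x^n$ for every $n\ge 1$, where $\overline{K_n}$ is the edgeless graph on $n$ vertices. In particular, there exists a graph polynomial (defined on all simple graphs) satisfying the recursion $P(G,x)=P(G-e,x)-P(G\Delta e,x)$ for every edge $e$ together with the initial condition $P(\overline{K_n},x)=x^n$; that is, the polynomial determined by this recursion does not depend on the order in which edges are chosen.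
   Context: All graphs are finite and simple. For a graph $G=(V,E)$ and $A\subseteq E$, $k(A)$ denotes the number of connected components of the spanning subgraph $(V,A)$, and $k(G)=k(E)$. The Tutte polynomial is $T(G,x,y)=\sum_{A\subseteq E}(x-1)^{k(A)-k(E)}(y-1)^{k(A)+|A|-|V|}$, and $Z_G(q,v)=\sum_{A\subseteq E}q^{k(A)}v^{|A|}$. For an edge $e$, $G-e$ is the graph obtained by deleting the edge $e$ (keeping all vertices). For an edge $e=(u,v)$, $G\Delta e$ is the simple graph obtained from $G$ by deleting the vertices $u$ and $v$ and adding a new vertex $w$ joined exactly to those vertices of $V(G)\setminus\{u,v\}$ that are adjacent in $G$ to exactly one of $u$ and $v$, i.e. $w$ is joined to the symmetric difference of $N(u)\setminus\{v\}$ and $N(v)\setminus\{u\}$. -}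

module Defs where

open import Data.Bool using (Bool; true; false; _∧_; _∨_; not; _xor_; T?)
open import Data.Bool.Properties using (∨-comm; ∧-comm; xor-comm)
open import Data.Nat as ℕ using (ℕ; zero; suc)
open import Data.Fin as Fin using (Fin; toℕ; punchIn)
open import Data.Fin.Properties using (_≟_)
open import Data.List as List using (List; []; _∷_; _++_; map; filter; allFin; concatMap; length; foldr)
open import Data.Bool.ListAction using (any)
open import Data.Product using (_×_; _,_; proj₁; proj₂)
open import Data.Integer using (+_)
open import Data.Rational as ℚ using (ℚ; 0ℚ; 1ℚ; _+_; _*_; -_; _/_)
open import Relation.Nullary using (yes; no; does)
open import Relation.Binary.PropositionalEquality using (_≡_; refl; sym; cong; cong₂; trans)

record Graph (n : ℕ) : Set where
  field
    adj    : Fin n → Fin n → Bool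
    symm   : ∀ x y → adj x y ≡ adj y x
    irrefl : ∀ x → adj x x ≡ false
open Graph public

_==_ : ∀ {n} → Fin n → Fin n → Bool
x == y = does (x ≟ y)

==-sym : ∀ {n} (x y : Fin n) → (x == y) ≡ (y == x)
==-sym x y with x ≟ y | y ≟ x
... | yes _ | yes _ = refl
... | no _  | no _  = refl
... | yes p | no ¬q = Data.Empty.⊥-elim (¬q (sym p))
  where import Data.Empty
... | no ¬p | yes q = Data.Empty.⊥-elim (¬p (sym q))
  where import Data.Empty

record Edge {n : ℕ} (G : Graph n) : Set where
  field
    u v    : Fin n
    isEdge : adj G u v ≡ true
open Edge public

pairs : (n : ℕ) → List (Fin n × Fin n)
pairs n = concatMap (λ i → map (λ j → (i , j)) (filter (λ j → toℕ i ℕ.<? toℕ j) (allFin n))) (allFin n)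

edges : ∀ {n} → Graph n → List (Fin n × Fin n)
edges {n} G = filter (λ p → T? (adj G (proj₁ p) (proj₂ p))) (pairs n)

subsets : ∀ {a} {X : Set a} → List X → List (List X)
subsets []       = [] ∷ []
subsets (x ∷ xs) = subsets xs ++ map (x ∷_) (subsets xs)

-- reachN t A x y : y is reachable from x by a walk of length ≤ t in (V , A)
reachN : ∀ {n} → ℕ → List (Fin n × Fin n) → Fin n → Fin n → Bool
reachN zero    A x y = x == y
reachN (suc t) A x y =
  reachN t A x y ∨
  any (λ p → (reachN t A x (proj₁ p) ∧ (proj₂ p == y)) ∨ (reachN t A x (proj₂ p) ∧ (proj₁ p == y))) A

-- connectivity in the spanning subgraph (V , A) (walks of length ≤ n suffice)
connected : ∀ {n} → List (Fin n × Fin n) → Fin n → Fin n → Bool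
connected {n} A = reachN n A

-- k(A): number of connected components of the spanning subgraph (V , A),
-- counted as the number of vertices that are the least vertex of their component
k : ∀ {n} → List (Fin n × Fin n) → ℕ
k {n} A = length (filter (λ y → T? (not (any (λ x → (toℕ x ℕ.<ᵇ toℕ y) ∧ connected A x y) (allFin n)))) (allFin n))

_^ℚ_ : ℚ → ℕ → ℚ
q ^ℚ zero  = 1ℚ
q ^ℚ suc m = q * (q ^ℚ m)

sumℚ : List ℚ → ℚ
sumℚ = foldr _+_ 0ℚ

Z : ∀ {n} → Graph n → ℚ → ℚ → ℚ
Z G q w = sumℚ (map (λ A → (q ^ℚ k A) * (w ^ℚ length A)) (subsets (edges G)))

two : ℚ
two = + 2 / 1

half : ℚ
half = + 1 / 2

P : ∀ {n} → Graph n → ℚ → ℚ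
P {n} G x = (half ^ℚ n) * Z G (two * x) (- two)

edgeMatch : ∀ {n} → Fin n → Fin n → Fin n → Fin n → Bool
edgeMatch u v x y = ((x == u) ∧ (y == v)) ∨ ((x == v) ∧ (y == u))

bool-lemma : ∀ a b c d → ((a ∧ b) ∨ (c ∧ d)) ≡ ((d ∧ c) ∨ (b ∧ a))
bool-lemma true  true  true  true  = refl
bool-lemma true  true  true  false = refl
bool-lemma true  true  false true  = refl
bool-lemma true  true  false false = refl
bool-lemma true  false true  true  = refl
bool-lemma true  false true  false = refl
bool-lemma true  false false true  = refl
bool-lemma true  false false false = refl
bool-lemma false true  true  true  = refl
bool-lemma false true  true  false = refl
bool-lemma false true  false true  = refl
bool-lemma false true  false false = refl
bool-lemma false false true  true  = refl
bool-lemma false false true  false = refl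
bool-lemma false false false true  = refl
bool-lemma false false false false = refl

edgeMatch-sym : ∀ {n} (u v x y : Fin n) → edgeMatch u v x y ≡ edgeMatch u v y x
edgeMatch-sym u v x y = bool-lemma (x == u) (y == v) (x == v) (y == u)

_─_ : ∀ {n} (G : Graph n) → Edge G → Graph n
adj    (G ─ e) x y = adj G x y ∧ not (edgeMatch (u e) (v e) x y)
symm   (G ─ e) x y rewrite symm G x y | edgeMatch-sym (u e) (v e) x y = refl
irrefl (G ─ e) x rewrite irrefl G x = refl

-- The vertex v is removed: vertex i of G Δ e is vertex  punchIn v i  of G
-- (a bijection Fin m ≅ V(G) ∖ {v}); the vertex corresponding to u plays the
-- role of the new vertex w, joined to the vertices y ∉ {u,v} adjacent to
-- exactly one of u and v.

Δadj : ∀ {m} (G : Graph (suc m)) → Edge G → Fin m → Fin m → Bool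
Δadj G e i j with punchIn (v e) i ≟ u e | punchIn (v e) j ≟ u e
... | yes _ | yes _ = false
... | yes _ | no _  = adj G (u e) (punchIn (v e) j) xor adj G (v e) (punchIn (v e) j)
... | no _  | yes _ = adj G (u e) (punchIn (v e) i) xor adj G (v e) (punchIn (v e) i)
... | no _  | no _  = adj G (punchIn (v e) i) (punchIn (v e) j)

Δadj-sym : ∀ {m} (G : Graph (suc m)) (e : Edge G) (i j : Fin m) → Δadj G e i j ≡ Δadj G e j i
Δadj-sym G e i j with punchIn (v e) i ≟ u e | punchIn (v e) j ≟ u e
... | yes _ | yes _ = refl
... | yes _ | no _  = refl
... | no _  | yes _ = refl
... | no _  | no _  = symm G (punchIn (v e) i) (punchIn (v e) j)

Δadj-irrefl : ∀ {m} (G : Graph (suc m)) (e : Edge G) (i : Fin m) → Δadj G e i i ≡ false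
Δadj-irrefl G e i with punchIn (v e) i ≟ u e
... | yes _ = refl
... | no _  = irrefl G (punchIn (v e) i)

_Δ_ : ∀ {m} (G : Graph (suc m)) → Edge G → Graph m
adj    (G Δ e) = Δadj G e
symm   (G Δ e) = Δadj-sym G e
irrefl (G Δ e) = Δadj-irrefl G e

edgeless : (n : ℕ) → Graph n
adj    (edgeless n) _ _ = false
symm   (edgeless n) _ _ = refl
irrefl (edgeless n) _   = refl

-- P(G, x) = 2^{-|V|} Z_G(2x, r) with r = -2. Splitting the subsets A ⊆ E according to whether they
-- contain e = uv gives Z_G = Z_{G - e} + r Z_{G/e}, where the multigraph G/e merges u and v: a subset
-- containing e has as many components as its image in G/e. As 2r + r² = 0, two parallel copies of an edge
-- contribute 1 + 2r + r² = 1 in total, as if neither were present, so Z_{G/e}(q, -2) only depends on the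
-- edge multiplicities modulo 2. Reducing them turns G/e into the simple graph G Δ e, and since r/2 = -1
-- the normalisation turns Z_G = Z_{G - e} + r Z_{G Δ e} into P(G) = P(G - e) - P(G Δ e).

module Submission where

open import Defs
open import Data.Bool using (Bool; true; false; _∧_; _∨_; not; _xor_; T; T?)
import Data.Bool.Properties as 𝔹
open import Data.Nat as ℕ using (ℕ; zero; suc; _+_; _≤_; _<_; z≤n; s≤s)
import Data.Nat.Properties as ℕ
open import Data.Fin as Fin using (Fin; toℕ; punchIn; punchOut)
import Data.Fin.Properties as Fin
open import Data.List using (List; []; _∷_; _++_; map; filter; allFin; length; tabulate; concat)
open import Data.List.Properties using (map-++; map-∘; map-cong; ++-identityʳ; filter-none)
open import Data.Bool.ListAction using (any)
open import Data.Rational as ℚ using (ℚ; 0ℚ; 1ℚ; -_; _-_)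
import Data.Rational.Properties as ℚ
open import Data.Rational.Solver using (module +-*-Solver)
open import Data.List.Relation.Binary.Permutation.Propositional as ↭ using (_↭_)
import Data.List.Relation.Binary.Permutation.Propositional.Properties as ↭
open import Data.List.Relation.Unary.All as All using (All; []; _∷_)
import Data.List.Relation.Unary.All.Properties as All
open import Data.Product using (_×_; _,_; proj₁; proj₂; ∃)
open import Data.Sum using (_⊎_; inj₁; inj₂; [_,_]; [_,_]′)
open import Data.Empty using (⊥; ⊥-elim)
open import Function using (_∘_)
open import Relation.Nullary using (yes; no; ¬_; does)
open import Relation.Nullary.Decidable using (dec-true; dec-false)
open import Relation.Unary using (Pred; Decidable)
open import Relation.Binary.Definitions using (tri<; tri≈; tri>)
open import Relation.Binary.PropositionalEquality
  using (_≡_; _≢_; refl; sym; trans; cong; cong₂; subst; module ≡-Reasoning)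

true≢false : true ≢ false
true≢false ()

bool-ext : ∀ {a b : Bool} → (a ≡ true → b ≡ true) → (b ≡ true → a ≡ true) → a ≡ b
bool-ext {false} {false} _ _ = refl
bool-ext {false} {true}  _ g = g refl
bool-ext {true}  {false} f _ = sym (f refl)
bool-ext {true}  {true}  _ _ = refl

∨-introˡ : ∀ {a} b → a ≡ true → a ∨ b ≡ true
∨-introˡ b refl = refl

∨-introʳ : ∀ a {b} → b ≡ true → a ∨ b ≡ true
∨-introʳ false refl = refl
∨-introʳ true  refl = refl

∨-elim : ∀ a {b} → a ∨ b ≡ true → a ≡ true ⊎ b ≡ true
∨-elim true  _ = inj₁ refl
∨-elim false p = inj₂ p

∧-intro : ∀ {a b} → a ≡ true → b ≡ true → a ∧ b ≡ true
∧-intro refl refl = refl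

∧-elimˡ : ∀ a {b} → a ∧ b ≡ true → a ≡ true
∧-elimˡ true _ = refl

∧-elimʳ : ∀ a {b} → a ∧ b ≡ true → b ≡ true
∧-elimʳ true p = p

not-∨ : ∀ a b → not (a ∨ b) ≡ not a ∧ not b
not-∨ true  b = refl
not-∨ false b = refl

∧-false-intro : ∀ a b → (a ≡ true → b ≡ true → ⊥) → a ∧ b ≡ false
∧-false-intro false b _     = refl
∧-false-intro true  false _ = refl
∧-false-intro true  true  h = ⊥-elim (h refl refl)

true-or-false : ∀ b → b ≡ true ⊎ b ≡ false
true-or-false true  = inj₁ refl
true-or-false false = inj₂ refl

xor-cancel : ∀ a b → a xor (a xor b) ≡ b
xor-cancel false b = refl
xor-cancel true  b = 𝔹.not-involutive b

xor-swap : ∀ a b c → a xor (b xor c) ≡ b xor (a xor c)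
xor-swap a b c = trans (sym (𝔹.xor-assoc a b c)) (trans (cong (_xor c) (𝔹.xor-comm a b)) (𝔹.xor-assoc b a c))

xor-interchange : ∀ a b c d → (a xor b) xor (c xor d) ≡ (a xor c) xor (b xor d)
xor-interchange a b c d =
  trans (𝔹.xor-assoc a b _) (trans (cong (a xor_) (xor-swap b c d)) (sym (𝔹.xor-assoc a c _)))

∧-∨≡∧-xor : ∀ g x y → (g ≡ true → x ≡ true → y ≡ true → ⊥) →
            g ∧ (x ∨ y) ≡ g ∧ (x xor y)
∧-∨≡∧-xor false x     y     _  = refl
∧-∨≡∧-xor true  false y     _  = refl
∧-∨≡∧-xor true  true  false _  = refl
∧-∨≡∧-xor true  true  true  ex = ⊥-elim (ex refl refl refl)

==-refl : ∀ {n} (x : Fin n) → (x == x) ≡ true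
==-refl x = dec-true (x Fin.≟ x) refl

==⇒≡ : ∀ {n} {x y : Fin n} → (x == y) ≡ true → x ≡ y
==⇒≡ {x = x} {y} p with x Fin.≟ y
... | yes x≡y = x≡y

≡⇒== : ∀ {n} {x y : Fin n} → x ≡ y → (x == y) ≡ true
≡⇒== {x = x} refl = ==-refl x

==-ext : ∀ {n} {x y : Fin n} {c : Bool} → (x ≡ y → c ≡ true) → (c ≡ true → x ≡ y) → (x == y) ≡ c
==-ext to from = bool-ext (to ∘ ==⇒≡) (≡⇒== ∘ from)

≢⇒==-false : ∀ {n} {x y : Fin n} → x ≢ y → (x == y) ≡ false
≢⇒==-false {x = x} {y} = dec-false (x Fin.≟ y)

anyᶠ : ∀ {n} → (Fin n → Bool) → Bool
anyᶠ {zero}  f = false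
anyᶠ {suc n} f = f Fin.zero ∨ anyᶠ (f ∘ Fin.suc)

bit : Bool → ℕ
bit true  = 1
bit false = 0

countᶠ : ∀ {n} → (Fin n → Bool) → ℕ
countᶠ {zero}  f = 0
countᶠ {suc n} f = bit (f Fin.zero) + countᶠ (f ∘ Fin.suc)

any-tabulate : ∀ {a} {A : Set a} {n} (f : A → Bool) (g : Fin n → A) →
               any f (tabulate g) ≡ anyᶠ (f ∘ g)
any-tabulate {n = zero}  f g = refl
any-tabulate {n = suc n} f g = cong (f (g Fin.zero) ∨_) (any-tabulate f (g ∘ Fin.suc))

any-cong : ∀ {a} {X : Set a} {f g : X → Bool} → (∀ x → f x ≡ g x) → ∀ xs → any f xs ≡ any g xs
any-cong h []       = refl
any-cong h (x ∷ xs) = cong₂ _∨_ (h x) (any-cong h xs)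

any-++ : ∀ {a} {X : Set a} (f : X → Bool) xs ys → any f (xs ++ ys) ≡ any f xs ∨ any f ys
any-++ f []       ys = refl
any-++ f (x ∷ xs) ys = trans (cong (f x ∨_) (any-++ f xs ys)) (sym (𝔹.∨-assoc (f x) _ _))

length-filter-tabulate : ∀ {a} {A : Set a} {n} (f : A → Bool) (g : Fin n → A) →
                         length (filter (T? ∘ f) (tabulate g)) ≡ countᶠ (f ∘ g)
length-filter-tabulate {n = zero}  f g = refl
length-filter-tabulate {n = suc n} f g with f (g Fin.zero)
... | true  = cong suc (length-filter-tabulate f (g ∘ Fin.suc))
... | false = length-filter-tabulate f (g ∘ Fin.suc)

anyᶠ-intro : ∀ {n} (f : Fin n → Bool) i → f i ≡ true → anyᶠ f ≡ true
anyᶠ-intro f Fin.zero    p = ∨-introˡ _ p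
anyᶠ-intro f (Fin.suc i) p = ∨-introʳ (f Fin.zero) (anyᶠ-intro (f ∘ Fin.suc) i p)

anyᶠ-elim : ∀ {n} (f : Fin n → Bool) → anyᶠ f ≡ true → ∃ λ i → f i ≡ true
anyᶠ-elim {suc n} f p with ∨-elim (f Fin.zero) p
... | inj₁ q = Fin.zero , q
... | inj₂ q with anyᶠ-elim (f ∘ Fin.suc) q
...   | i , r = Fin.suc i , r

anyᶠ-false : ∀ {n} (f : Fin n → Bool) → (∀ i → f i ≡ false) → anyᶠ f ≡ false
anyᶠ-false {zero}  f h = refl
anyᶠ-false {suc n} f h rewrite h Fin.zero = anyᶠ-false (f ∘ Fin.suc) (h ∘ Fin.suc)

anyᶠ-false⁻ : ∀ {n} (f : Fin n → Bool) → anyᶠ f ≡ false → ∀ i → f i ≡ false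
anyᶠ-false⁻ f p i with f i in fi
... | false = refl
... | true  = ⊥-elim (true≢false (trans (sym (anyᶠ-intro f i fi)) p))

anyᶠ-cong : ∀ {n} {f g : Fin n → Bool} → (∀ i → f i ≡ g i) → anyᶠ f ≡ anyᶠ g
anyᶠ-cong {zero}  h = refl
anyᶠ-cong {suc n} h = cong₂ _∨_ (h Fin.zero) (anyᶠ-cong (h ∘ Fin.suc))

anyᶠ-∨ : ∀ {n} (f g : Fin n → Bool) → anyᶠ (λ i → f i ∨ g i) ≡ anyᶠ f ∨ anyᶠ g
anyᶠ-∨ f g = bool-ext
  (λ p → let i , q = anyᶠ-elim _ p in
     [ ∨-introˡ _ ∘ anyᶠ-intro f i , ∨-introʳ (anyᶠ f) ∘ anyᶠ-intro g i ] (∨-elim (f i) q))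
  (λ p → [ (λ q → let i , r = anyᶠ-elim f q in anyᶠ-intro _ i (∨-introˡ _ r))
         , (λ q → let i , r = anyᶠ-elim g q in anyᶠ-intro _ i (∨-introʳ (f i) r))
         ] (∨-elim (anyᶠ f) p))

anyᶠ-== : ∀ {n} (a : Fin n) (g : Fin n → Bool) → anyᶠ (λ z → (a == z) ∧ g z) ≡ g a
anyᶠ-== a g = bool-ext
  (λ p → let z , q = anyᶠ-elim _ p in
     subst (λ w → g w ≡ true) (sym (==⇒≡ (∧-elimˡ (a == z) q))) (∧-elimʳ (a == z) q))
  (λ p → anyᶠ-intro _ a (∧-intro (==-refl a) p))

anyᶠ-punchIn : ∀ {m} (w : Fin (suc m)) (f : Fin (suc m) → Bool) →
               anyᶠ f ≡ f w ∨ anyᶠ (f ∘ punchIn w)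
anyᶠ-punchIn w f = bool-ext
  (λ p → let i , fi = anyᶠ-elim f p in split i fi)
  (λ p → [ anyᶠ-intro f w
         , (λ q → let j , r = anyᶠ-elim (f ∘ punchIn w) q in anyᶠ-intro f (punchIn w j) r)
         ] (∨-elim (f w) p))
  where
  split : ∀ i → f i ≡ true → f w ∨ anyᶠ (f ∘ punchIn w) ≡ true
  split i fi with w Fin.≟ i
  ... | yes refl = ∨-introˡ _ fi
  ... | no w≢i   = ∨-introʳ (f w) (anyᶠ-intro (f ∘ punchIn w) (punchOut w≢i)
                     (subst (λ z → f z ≡ true) (sym (Fin.punchIn-punchOut w≢i)) fi))

countᶠ-cong : ∀ {n} {f g : Fin n → Bool} → (∀ i → f i ≡ g i) → countᶠ f ≡ countᶠ g
countᶠ-cong {zero}  h = refl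
countᶠ-cong {suc n} h = cong₂ _+_ (cong bit (h Fin.zero)) (countᶠ-cong (h ∘ Fin.suc))

countᶠ-false : ∀ {n} (f : Fin n → Bool) → (∀ i → f i ≡ false) → countᶠ f ≡ 0
countᶠ-false {zero}  f h = refl
countᶠ-false {suc n} f h rewrite h Fin.zero = countᶠ-false (f ∘ Fin.suc) (h ∘ Fin.suc)

countᶠ-true : ∀ n → countᶠ {n} (λ _ → true) ≡ n
countᶠ-true zero    = refl
countᶠ-true (suc n) = cong suc (countᶠ-true n)

countᶠ-≤ : ∀ {n} (f : Fin n → Bool) → countᶠ f ≤ n
countᶠ-≤ {zero}  f = z≤n
countᶠ-≤ {suc n} f with f Fin.zero
... | true  = s≤s (countᶠ-≤ (f ∘ Fin.suc))
... | false = ℕ.m≤n⇒m≤1+n (countᶠ-≤ (f ∘ Fin.suc))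

countᶠ-mono : ∀ {n} (f g : Fin n → Bool) → (∀ i → f i ≡ true → g i ≡ true) →
              countᶠ f ≤ countᶠ g
countᶠ-mono {zero}  f g h = z≤n
countᶠ-mono {suc n} f g h with f Fin.zero in f₀ | g Fin.zero in g₀
... | true  | true  = s≤s (countᶠ-mono _ _ (h ∘ Fin.suc))
... | false | true  = ℕ.m≤n⇒m≤1+n (countᶠ-mono _ _ (h ∘ Fin.suc))
... | false | false = countᶠ-mono _ _ (h ∘ Fin.suc)
... | true  | false = ⊥-elim (true≢false (trans (sym (h Fin.zero f₀)) g₀))

countᶠ-punchIn : ∀ {m} (w : Fin (suc m)) (f : Fin (suc m) → Bool) →
                 countᶠ f ≡ bit (f w) + countᶠ (f ∘ punchIn w)
countᶠ-punchIn Fin.zero f = refl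
countᶠ-punchIn {suc m} (Fin.suc w) f = begin
  a + countᶠ (f ∘ Fin.suc)  ≡⟨ cong (a +_) (countᶠ-punchIn w (f ∘ Fin.suc)) ⟩
  a + (b + c)               ≡⟨ ℕ.+-comm a (b + c) ⟩
  (b + c) + a               ≡⟨ ℕ.+-assoc b c a ⟩
  b + (c + a)               ≡⟨ cong (b +_) (ℕ.+-comm c a) ⟩
  b + (a + c)               ∎
  where
  open ≡-Reasoning
  a = bit (f Fin.zero)
  b = bit (f (Fin.suc w))
  c = countᶠ (f ∘ Fin.suc ∘ punchIn w)

countᶠ-strict : ∀ {n} (f g : Fin n → Bool) → (∀ i → f i ≡ true → g i ≡ true) →
                ∀ w → f w ≡ false → g w ≡ true → suc (countᶠ f) ≤ countᶠ g
countᶠ-strict {suc m} f g f⇒g w fw gw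
  rewrite countᶠ-punchIn w f | countᶠ-punchIn w g | fw | gw =
  s≤s (countᶠ-mono _ _ (f⇒g ∘ punchIn w))

countᶠ-unique : ∀ {n} (f : Fin n → Bool) i → f i ≡ true → (∀ j → f j ≡ true → j ≡ i) →
                countᶠ f ≡ 1
countᶠ-unique {suc n} f i fi unique =
  trans (countᶠ-punchIn i f) (cong₂ _+_ (cong bit fi) (countᶠ-false _ others))
  where
  others : ∀ j → f (punchIn i j) ≡ false
  others j with f (punchIn i j) in fj
  ... | false = refl
  ... | true  = ⊥-elim (Fin.punchInᵢ≢i i j (unique _ fj))

countᶠ-split : ∀ {n} (f c : Fin n → Bool) →
               countᶠ f ≡ countᶠ (λ i → f i ∧ c i) + countᶠ (λ i → f i ∧ not (c i))
countᶠ-split {zero}  f c = refl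
countᶠ-split {suc n} f c with f Fin.zero | c Fin.zero
... | false | _     = countᶠ-split (f ∘ Fin.suc) (c ∘ Fin.suc)
... | true  | true  = cong suc (countᶠ-split (f ∘ Fin.suc) (c ∘ Fin.suc))
... | true  | false = trans (cong suc (countᶠ-split (f ∘ Fin.suc) (c ∘ Fin.suc))) (sym (ℕ.+-suc _ _))

-- Reachability in the spanning subgraph of an edge list

Pair : ℕ → Set
Pair n = Fin n × Fin n

links : ∀ {n} → Pair n → Fin n → Fin n → Bool
links (a , b) z y = ((a == z) ∧ (b == y)) ∨ ((b == z) ∧ (a == y))

links-sym : ∀ {n} (p : Pair n) z y → links p z y ≡ links p y z
links-sym (a , b) z y = bool-lemma (a == z) (b == y) (b == z) (a == y)

links-self : ∀ {n} (p : Pair n) → links p (proj₁ p) (proj₂ p) ≡ true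
links-self (a , b) = ∨-introˡ _ (∧-intro (==-refl a) (==-refl b))

links-self′ : ∀ {n} (p : Pair n) → links p (proj₂ p) (proj₁ p) ≡ true
links-self′ p = trans (links-sym p _ _) (links-self p)

links-elim : ∀ {n} (p : Pair n) z y → links p z y ≡ true →
             (proj₁ p ≡ z × proj₂ p ≡ y) ⊎ (proj₂ p ≡ z × proj₁ p ≡ y)
links-elim (a , b) z y l with ∨-elim ((a == z) ∧ (b == y)) l
... | inj₁ q = inj₁ (==⇒≡ (∧-elimˡ (a == z) q) , ==⇒≡ (∧-elimʳ (a == z) q))
... | inj₂ q = inj₂ (==⇒≡ (∧-elimˡ (b == z) q) , ==⇒≡ (∧-elimʳ (b == z) q))

adjacent : ∀ {n} → List (Pair n) → Fin n → Fin n → Bool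
adjacent A z y = any (λ p → links p z y) A

adjacent-sym : ∀ {n} (A : List (Pair n)) z y → adjacent A z y ≡ adjacent A y z
adjacent-sym A z y = any-cong (λ p → links-sym p z y) A

SameAdjacency : ∀ {n} → List (Pair n) → List (Pair n) → Set
SameAdjacency A B = ∀ z y → adjacent A z y ≡ adjacent B z y

adjacent-swap : ∀ {n} x y (P : List (Pair n)) → SameAdjacency (x ∷ y ∷ P) (y ∷ x ∷ P)
adjacent-swap x y P z w = begin
  X ∨ (Y ∨ adjacent P z w)  ≡⟨ sym (𝔹.∨-assoc X Y _) ⟩
  (X ∨ Y) ∨ adjacent P z w  ≡⟨ cong (_∨ adjacent P z w) (𝔹.∨-comm X Y) ⟩
  (Y ∨ X) ∨ adjacent P z w  ≡⟨ 𝔹.∨-assoc Y X _ ⟩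
  Y ∨ (X ∨ adjacent P z w)  ∎
  where
  open ≡-Reasoning
  X = links x z w
  Y = links y z w

adjacent-∷-cong : ∀ {n} x {P P′ : List (Pair n)} → SameAdjacency P P′ →
                  SameAdjacency (x ∷ P) (x ∷ P′)
adjacent-∷-cong x P≈P′ z y = cong (links x z y ∨_) (P≈P′ z y)

SameLinks : ∀ {n} → Pair n → Pair n → Set
SameLinks x x′ = ∀ z y → links x z y ≡ links x′ z y

adjacent-head : ∀ {n} {x x′ : Pair n} → SameLinks x x′ → ∀ P → SameAdjacency (x ∷ P) (x′ ∷ P)
adjacent-head x≈x′ P z y = cong (_∨ adjacent P z y) (x≈x′ z y)

adjacent-dup : ∀ {n} x (P : List (Pair n)) → SameAdjacency (x ∷ x ∷ P) (x ∷ P)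
adjacent-dup x P z y = trans (sym (𝔹.∨-assoc (links x z y) _ _)) (cong (_∨ adjacent P z y) (𝔹.∨-idem _))

adjacent-move : ∀ {n} x (A P : List (Pair n)) → SameAdjacency (x ∷ A ++ P) (A ++ x ∷ P)
adjacent-move x A P z y = begin
  X ∨ adjacent (A ++ P) z y              ≡⟨ cong (X ∨_) (any-++ _ A P) ⟩
  X ∨ (adjacent A z y ∨ adjacent P z y)  ≡⟨ sym (𝔹.∨-assoc X _ _) ⟩
  (X ∨ adjacent A z y) ∨ adjacent P z y  ≡⟨ cong (_∨ adjacent P z y) (𝔹.∨-comm X _) ⟩
  (adjacent A z y ∨ X) ∨ adjacent P z y  ≡⟨ 𝔹.∨-assoc (adjacent A z y) _ _ ⟩
  adjacent A z y ∨ adjacent (x ∷ P) z y  ≡⟨ sym (any-++ _ A (x ∷ P)) ⟩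
  adjacent (A ++ x ∷ P) z y              ∎
  where
  open ≡-Reasoning
  X = links x z y

anyᶠ-links : ∀ {n} (R : Fin n → Bool) (p : Pair n) y →
             anyᶠ (λ z → R z ∧ links p z y)
               ≡ (R (proj₁ p) ∧ (proj₂ p == y)) ∨ (R (proj₂ p) ∧ (proj₁ p == y))
anyᶠ-links R (a , b) y = begin
  anyᶠ (λ z → R z ∧ links (a , b) z y)
    ≡⟨ anyᶠ-cong (λ z → shuffle (R z) (a == z) (b == y) (b == z) (a == y)) ⟩
  anyᶠ (λ z → ((a == z) ∧ (R z ∧ (b == y))) ∨ ((b == z) ∧ (R z ∧ (a == y))))
    ≡⟨ anyᶠ-∨ (λ z → (a == z) ∧ (R z ∧ (b == y))) (λ z → (b == z) ∧ (R z ∧ (a == y))) ⟩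
  anyᶠ (λ z → (a == z) ∧ (R z ∧ (b == y))) ∨ anyᶠ (λ z → (b == z) ∧ (R z ∧ (a == y)))
    ≡⟨ cong₂ _∨_ (anyᶠ-== a _) (anyᶠ-== b _) ⟩
  (R a ∧ (b == y)) ∨ (R b ∧ (a == y))
    ∎
  where
  open ≡-Reasoning
  shuffle : ∀ r a b c d → r ∧ ((a ∧ b) ∨ (c ∧ d)) ≡ (a ∧ (r ∧ b)) ∨ (c ∧ (r ∧ d))
  shuffle true  a     b c     d = refl
  shuffle false false b false d = refl
  shuffle false false b true  d = refl
  shuffle false true  b false d = refl
  shuffle false true  b true  d = refl

reachN-suc : ∀ {n} t (A : List (Pair n)) x y →
             reachN (suc t) A x y ≡ reachN t A x y ∨ anyᶠ (λ z → reachN t A x z ∧ adjacent A z y)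
reachN-suc t A x y = cong (reachN t A x y ∨_) (step A)
  where
  R = reachN t A x
  hop : Pair _ → Bool
  hop p = (R (proj₁ p) ∧ (proj₂ p == y)) ∨ (R (proj₂ p) ∧ (proj₁ p == y))
  step : ∀ B → any hop B ≡ anyᶠ (λ z → R z ∧ adjacent B z y)
  step []      = sym (anyᶠ-false _ (λ z → 𝔹.∧-zeroʳ (R z)))
  step (p ∷ B) = begin
    hop p ∨ any hop B
      ≡⟨ cong₂ _∨_ (sym (anyᶠ-links R p y)) (step B) ⟩
    anyᶠ (λ z → R z ∧ links p z y) ∨ anyᶠ (λ z → R z ∧ adjacent B z y)
      ≡⟨ sym (anyᶠ-∨ (λ z → R z ∧ links p z y) _) ⟩
    anyᶠ (λ z → (R z ∧ links p z y) ∨ (R z ∧ adjacent B z y))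
      ≡⟨ anyᶠ-cong (λ z → sym (𝔹.∧-distribˡ-∨ (R z) _ _)) ⟩
    anyᶠ (λ z → R z ∧ adjacent (p ∷ B) z y)
      ∎
    where open ≡-Reasoning

reachN-cong : ∀ {n} {A B : List (Pair n)} → SameAdjacency A B → ∀ t x y → reachN t A x y ≡ reachN t B x y
reachN-cong A≈B zero    x y = refl
reachN-cong {A = A} {B} A≈B (suc t) x y = begin
  reachN (suc t) A x y
    ≡⟨ reachN-suc t A x y ⟩
  reachN t A x y ∨ anyᶠ (λ z → reachN t A x z ∧ adjacent A z y)
    ≡⟨ cong₂ _∨_ (reachN-cong A≈B t x y)
                 (anyᶠ-cong (λ z → cong₂ _∧_ (reachN-cong A≈B t x z) (A≈B z y))) ⟩
  reachN t B x y ∨ anyᶠ (λ z → reachN t B x z ∧ adjacent B z y)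
    ≡⟨ sym (reachN-suc t B x y) ⟩
  reachN (suc t) B x y
    ∎
  where open ≡-Reasoning

module Reachability {n : ℕ} (A : List (Pair n)) where

  reach : ℕ → Fin n → Fin n → Bool
  reach t = reachN t A

  reach-suc : ∀ t x y → reach t x y ≡ true → reach (suc t) x y ≡ true
  reach-suc t x y = ∨-introˡ _

  reach-mono : ∀ {t t′} → t ≤ t′ → ∀ x y → reach t x y ≡ true → reach t′ x y ≡ true
  reach-mono {t} {t′} t≤t′ x y p with ℕ.m≤n⇒∃[o]m+o≡n t≤t′
  ... | j , refl = go j
    where
    go : ∀ j → reach (t + j) x y ≡ true
    go zero    = subst (λ s → reach s x y ≡ true) (sym (ℕ.+-identityʳ t)) p
    go (suc j) = subst (λ s → reach s x y ≡ true) (sym (ℕ.+-suc t j)) (reach-suc (t + j) x y (go j))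

  reach-step : ∀ t x z y → reach t x z ≡ true → adjacent A z y ≡ true → reach (suc t) x y ≡ true
  reach-step t x z y p q =
    trans (reachN-suc t A x y) (∨-introʳ (reach t x y) (anyᶠ-intro _ z (∧-intro p q)))

  reach-suc-elim : ∀ t x y → reach (suc t) x y ≡ true →
                   reach t x y ≡ true ⊎ ∃ λ z → reach t x z ≡ true × adjacent A z y ≡ true
  reach-suc-elim t x y p with ∨-elim (reach t x y) (trans (sym (reachN-suc t A x y)) p)
  ... | inj₁ q = inj₁ q
  ... | inj₂ q = let z , r = anyᶠ-elim _ q in inj₂ (z , ∧-elimˡ _ r , ∧-elimʳ _ r)

  reach-trans : ∀ s t x y z → reach s x y ≡ true → reach t y z ≡ true → reach (s + t) x z ≡ true
  reach-trans s zero x y z p q rewrite ℕ.+-identityʳ s | ==⇒≡ {x = y} q = p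
  reach-trans s (suc t) x y z p q rewrite ℕ.+-suc s t with reach-suc-elim t y z q
  ... | inj₁ r           = reach-suc (s + t) x z (reach-trans s t x y z p r)
  ... | inj₂ (w , r , a) = reach-step (s + t) x w z (reach-trans s t x y w p r) a

  adjacent⇒reach : ∀ x y → adjacent A x y ≡ true → reach 1 x y ≡ true
  adjacent⇒reach x y = reach-step 0 x x y (==-refl x)

  reach-sym : ∀ t x y → reach t x y ≡ true → reach t y x ≡ true
  reach-sym zero x y p rewrite ==⇒≡ {x = x} p = ==-refl y
  reach-sym (suc t) x y p with reach-suc-elim t x y p
  ... | inj₁ r           = reach-suc t y x (reach-sym t x y r)
  ... | inj₂ (w , r , a) =
    reach-trans 1 t y w x (adjacent⇒reach y w (trans (adjacent-sym A y w) a)) (reach-sym t x w r)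

  Stable : Fin n → ℕ → Set
  Stable x t = ∀ y → reach (suc t) x y ≡ reach t x y

  stable-suc : ∀ x t → Stable x t → Stable x (suc t)
  stable-suc x t st y = begin
    reach (suc (suc t)) x y
      ≡⟨ reachN-suc (suc t) A x y ⟩
    reach (suc t) x y ∨ anyᶠ (λ z → reach (suc t) x z ∧ adjacent A z y)
      ≡⟨ cong₂ _∨_ (st y) (anyᶠ-cong (λ z → cong (_∧ adjacent A z y) (st z))) ⟩
    reach t x y ∨ anyᶠ (λ z → reach t x z ∧ adjacent A z y)
      ≡⟨ sym (reachN-suc t A x y) ⟩
    reach (suc t) x y
      ∎
    where open ≡-Reasoning

  stable-+ : ∀ x t → Stable x t → ∀ j y → reach (j + t) x y ≡ reach t x y
  stable-+ x t st zero    y = refl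
  stable-+ x t st (suc j) y = trans (stable-suc′ j y) (stable-+ x t st j y)
    where
    stable-suc′ : ∀ j → Stable x (j + t)
    stable-suc′ zero    = st
    stable-suc′ (suc j) = stable-suc x (j + t) (stable-suc′ j)

  -- The set reachable from x grows strictly until it stabilises, so it stabilises within n steps.
  grows-or-stable : ∀ x t → suc t ≤ countᶠ (reach t x) ⊎ ∃ λ s → s ≤ t × Stable x s
  grows-or-stable x zero =
    inj₁ (subst (λ c → suc c ≤ countᶠ (reach 0 x)) (countᶠ-false {n} _ (λ _ → refl))
                (countᶠ-strict (λ _ → false) (reach 0 x) (λ _ ()) x refl (==-refl x)))
  grows-or-stable x (suc t) with grows-or-stable x t
  ... | inj₂ (s , s≤t , st) = inj₂ (s , ℕ.m≤n⇒m≤1+n s≤t , st)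
  ... | inj₁ grown with anyᶠ (λ y → not (reach t x y) ∧ reach (suc t) x y) in new
  ...   | true  = let y , q = anyᶠ-elim _ new in
                  inj₁ (ℕ.≤-trans (s≤s grown)
                         (countᶠ-strict (reach t x) (reach (suc t) x) (reach-suc t x) y
                            (𝔹.not-injective (∧-elimˡ (not (reach t x y)) q))
                            (∧-elimʳ (not (reach t x y)) q)))
  ...   | false = inj₂ (t , ℕ.n≤1+n t , λ y → bool-ext (old y) (reach-suc t x y))
    where
    old : ∀ y → reach (suc t) x y ≡ true → reach t x y ≡ true
    old y p = 𝔹.not-injective (begin
      not (reach t x y)                       ≡⟨ sym (𝔹.∧-identityʳ _) ⟩
      not (reach t x y) ∧ true                ≡⟨ cong (not (reach t x y) ∧_) (sym p) ⟩
      not (reach t x y) ∧ reach (suc t) x y   ≡⟨ anyᶠ-false⁻ _ new y ⟩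
      false                                   ∎)
      where open ≡-Reasoning

  saturate : ∀ t x y → reach t x y ≡ true → connected A x y ≡ true
  saturate t x y p with grows-or-stable x n
  ... | inj₁ n<count = ⊥-elim (ℕ.<-irrefl refl (ℕ.<-≤-trans n<count (countᶠ-≤ (reach n x))))
  ... | inj₂ (s , s≤n , st) =
    reach-mono s≤n x y (trans (sym (stable-+ x s st t y)) (reach-mono (ℕ.m≤m+n t s) x y p))

  connected-refl : ∀ x → connected A x x ≡ true
  connected-refl x = saturate 0 x x (==-refl x)

  connected-sym : ∀ x y → connected A x y ≡ true → connected A y x ≡ true
  connected-sym = reach-sym n

  connected-trans : ∀ x y z → connected A x y ≡ true → connected A y z ≡ true → connected A x z ≡ true
  connected-trans x y z p q = saturate (n + n) x z (reach-trans n n x y z p q)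

  adjacent⇒connected : ∀ x y → adjacent A x y ≡ true → connected A x y ≡ true
  adjacent⇒connected x y a = saturate 1 x y (adjacent⇒reach x y a)

-- Counting classes by their least elements

_<ᵇ_ : ∀ {n} → Fin n → Fin n → Bool
x <ᵇ y = toℕ x ℕ.<ᵇ toℕ y

<ᵇ⇒< : ∀ {n} {x y : Fin n} → (x <ᵇ y) ≡ true → toℕ x < toℕ y
<ᵇ⇒< {x = x} {y} p = ℕ.<ᵇ⇒< (toℕ x) (toℕ y) (subst T (sym p) _)

<⇒<ᵇ : ∀ {n} {x y : Fin n} → toℕ x < toℕ y → (x <ᵇ y) ≡ true
<⇒<ᵇ {x = x} {y} p with x <ᵇ y | ℕ.<⇒<ᵇ p
... | true | _ = refl

≮⇒<ᵇ-false : ∀ {n} {x y : Fin n} → ¬ toℕ x < toℕ y → (x <ᵇ y) ≡ false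
≮⇒<ᵇ-false {x = x} {y} x≮y with x <ᵇ y in p
... | false = refl
... | true  = ⊥-elim (x≮y (<ᵇ⇒< p))

<ᵇ-irrefl : ∀ {n} (x : Fin n) → (x <ᵇ x) ≡ false
<ᵇ-irrefl x = ≮⇒<ᵇ-false {x = x} {x} (ℕ.<-irrefl refl)

punchIn-<ᵇ : ∀ {m} (w : Fin (suc m)) (j i : Fin m) → (punchIn w j <ᵇ punchIn w i) ≡ (j <ᵇ i)
punchIn-<ᵇ w j i = bool-ext
  (λ p → <⇒<ᵇ (ℕ.≰⇒> λ i≤j → ℕ.<⇒≱ (<ᵇ⇒< p) (Fin.punchIn-mono-≤ w i j i≤j)))
  (λ p → <⇒<ᵇ (ℕ.≰⇒> λ pi≤pj → ℕ.<⇒≱ (<ᵇ⇒< p) (Fin.punchIn-cancel-≤ w i j pi≤pj)))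

least : ∀ {n} → (Fin n → Fin n → Bool) → Fin n → Bool
least R y = not (anyᶠ (λ x → (x <ᵇ y) ∧ R x y))

classCount : ∀ {n} → (Fin n → Fin n → Bool) → ℕ
classCount R = countᶠ (least R)

least-minimal : ∀ {n} (R : Fin n → Fin n → Bool) y → least R y ≡ true →
                ∀ x → R x y ≡ true → ¬ toℕ x < toℕ y
least-minimal R y ly x r x<y =
  true≢false (trans (sym (∧-intro (<⇒<ᵇ x<y) r)) (anyᶠ-false⁻ _ (𝔹.not-injective ly) x))

minimal : ∀ {n} (Q : Fin n → Bool) a → Q a ≡ true →
          ∃ λ i → Q i ≡ true × (∀ j → toℕ j < toℕ i → Q j ≡ false)
minimal Q Fin.zero    qa = Fin.zero , qa , λ _ ()
minimal Q (Fin.suc a) qa with Q Fin.zero in q₀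
... | true  = Fin.zero , q₀ , λ _ ()
... | false with minimal (Q ∘ Fin.suc) a qa
...   | i , qi , below = Fin.suc i , qi , λ where
          Fin.zero    _       → q₀
          (Fin.suc j) (s≤s p) → below j p

module Classes {n : ℕ} (R : Fin n → Fin n → Bool)
  (R-refl  : ∀ x → R x x ≡ true)
  (R-sym   : ∀ x y → R x y ≡ true → R y x ≡ true)
  (R-trans : ∀ x y z → R x y ≡ true → R y z ≡ true → R x z ≡ true) where

  least-unique : ∀ i j → least R i ≡ true → least R j ≡ true → R i j ≡ true → i ≡ j
  least-unique i j li lj r with ℕ.<-cmp (toℕ i) (toℕ j)
  ... | tri< i<j _ _ = ⊥-elim (least-minimal R j lj i r i<j)
  ... | tri≈ _ i≡j _ = Fin.toℕ-injective i≡j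
  ... | tri> _ _ j<i = ⊥-elim (least-minimal R i li j (R-sym i j r) j<i)

  least-exists : ∀ x → ∃ λ i → R x i ≡ true × least R i ≡ true
  least-exists x with minimal (R x) x (R-refl x)
  ... | i , rxi , below = i , rxi , cong not (anyᶠ-false _ lower-not-related)
    where
    lower-not-related : ∀ j → (j <ᵇ i) ∧ R j i ≡ false
    lower-not-related j = ∧-false-intro (j <ᵇ i) (R j i) λ j<i rji →
      true≢false (trans (sym (R-trans x i j rxi (R-sym j i rji))) (below j (<ᵇ⇒< j<i)))

-- Away from v, φ is a bijection with inverse punchIn v; the only change in the least elements is that v
-- takes over from the least element of the class of φ v when v lies below it.
module Collapse {m : ℕ} (v : Fin (suc m)) (φ : Fin (suc m) → Fin m)
  (φ-punchIn : ∀ i → φ (punchIn v i) ≡ i)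
  (R : Fin (suc m) → Fin (suc m) → Bool) (R′ : Fin m → Fin m → Bool)
  (R≡R′∘φ : ∀ y z → R y z ≡ R′ (φ y) (φ z))
  (R′-refl  : ∀ x → R′ x x ≡ true)
  (R′-sym   : ∀ x y → R′ x y ≡ true → R′ y x ≡ true)
  (R′-trans : ∀ x y z → R′ x y ≡ true → R′ y z ≡ true → R′ x z ≡ true) where

  open Classes R′ R′-refl R′-sym R′-trans

  u′ : Fin m
  u′ = φ v

  R-punchIn : ∀ j i → R (punchIn v j) (punchIn v i) ≡ R′ j i
  R-punchIn j i = trans (R≡R′∘φ _ _) (cong₂ R′ (φ-punchIn j) (φ-punchIn i))

  R-v-punchIn : ∀ i → R v (punchIn v i) ≡ R′ u′ i
  R-v-punchIn i = trans (R≡R′∘φ _ _) (cong (R′ u′) (φ-punchIn i))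

  R-punchIn-v : ∀ j → R (punchIn v j) v ≡ R′ j u′
  R-punchIn-v j = trans (R≡R′∘φ _ _) (cong (λ z → R′ z u′) (φ-punchIn j))

  in-class-above-v : Fin m → Bool
  in-class-above-v i = (v <ᵇ punchIn v i) ∧ R′ u′ i

  least-punchIn : ∀ i → least R (punchIn v i) ≡ least R′ i ∧ not (in-class-above-v i)
  least-punchIn i = begin
    not (anyᶠ (λ x → (x <ᵇ w) ∧ R x w))
      ≡⟨ cong not (anyᶠ-punchIn v (λ x → (x <ᵇ w) ∧ R x w)) ⟩
    not (((v <ᵇ w) ∧ R v w) ∨ anyᶠ (λ j → (punchIn v j <ᵇ w) ∧ R (punchIn v j) w))
      ≡⟨ cong not (cong₂ _∨_ (cong ((v <ᵇ w) ∧_) (R-v-punchIn i))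
                             (anyᶠ-cong λ j → cong₂ _∧_ (punchIn-<ᵇ v j i) (R-punchIn j i))) ⟩
    not (in-class-above-v i ∨ anyᶠ (λ j → (j <ᵇ i) ∧ R′ j i))
      ≡⟨ not-∨ (in-class-above-v i) _ ⟩
    not (in-class-above-v i) ∧ least R′ i
      ≡⟨ 𝔹.∧-comm (not (in-class-above-v i)) _ ⟩
    least R′ i ∧ not (in-class-above-v i)
      ∎
    where
    open ≡-Reasoning
    w = punchIn v i

  in-class-below-v : Fin m → Bool
  in-class-below-v j = (punchIn v j <ᵇ v) ∧ R′ j u′

  class-below-v : Bool
  class-below-v = anyᶠ in-class-below-v

  least-v : least R v ≡ not class-below-v
  least-v = cong not (begin
    anyᶠ (λ x → (x <ᵇ v) ∧ R x v)
      ≡⟨ anyᶠ-punchIn v (λ x → (x <ᵇ v) ∧ R x v) ⟩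
    ((v <ᵇ v) ∧ R v v) ∨ anyᶠ (λ j → (punchIn v j <ᵇ v) ∧ R (punchIn v j) v)
      ≡⟨ cong₂ _∨_ (cong (_∧ R v v) (<ᵇ-irrefl v))
                   (anyᶠ-cong λ j → cong ((punchIn v j <ᵇ v) ∧_) (R-punchIn-v j)) ⟩
    class-below-v
      ∎)
    where open ≡-Reasoning

  no-least-above-v : class-below-v ≡ true → ∀ i → least R′ i ∧ in-class-above-v i ≡ false
  no-least-above-v below i = ∧-false-intro _ _ λ li above →
    let j , j-below = anyᶠ-elim in-class-below-v below
        pj<v = <ᵇ⇒< (∧-elimˡ (punchIn v j <ᵇ v) j-below)
        v<pi = <ᵇ⇒< (∧-elimˡ (v <ᵇ punchIn v i) above)
        j≮i  = least-minimal R′ i li j (R′-trans j u′ i (∧-elimʳ (punchIn v j <ᵇ v) j-below)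
                                                        (∧-elimʳ (v <ᵇ punchIn v i) above))
    in ℕ.<-asym v<pi (ℕ.≤-<-trans (Fin.punchIn-mono-≤ v i j (ℕ.≮⇒≥ j≮i)) pj<v)

  one-least-above-v : class-below-v ≡ false → countᶠ (λ i → least R′ i ∧ in-class-above-v i) ≡ 1
  one-least-above-v ¬below = countᶠ-unique _ i₀ (∧-intro li₀ (∧-intro (v<punchIn i₀ ri₀) ri₀)) unique
    where
    i₀ = proj₁ (least-exists u′)
    ri₀ = proj₁ (proj₂ (least-exists u′))
    li₀ = proj₂ (proj₂ (least-exists u′))
    v<punchIn : ∀ i → R′ u′ i ≡ true → (v <ᵇ punchIn v i) ≡ true
    v<punchIn i r = <⇒<ᵇ (ℕ.≤∧≢⇒< (ℕ.≮⇒≥ pi≮v) (Fin.punchInᵢ≢i v i ∘ sym ∘ Fin.toℕ-injective))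
      where
      pi≮v : ¬ toℕ (punchIn v i) < toℕ v
      pi≮v p = true≢false (trans (sym (∧-intro (<⇒<ᵇ p) (R′-sym u′ i r)))
                                 (anyᶠ-false⁻ in-class-below-v ¬below i))
    unique : ∀ i → least R′ i ∧ in-class-above-v i ≡ true → i ≡ i₀
    unique i h = least-unique i i₀ (∧-elimˡ (least R′ i) h) li₀
                   (R′-trans i u′ i₀ (R′-sym u′ i ri) ri₀)
      where
      ri = ∧-elimʳ (v <ᵇ punchIn v i) (∧-elimʳ (least R′ i) h)

  bit-least-v : bit (least R v) ≡ countᶠ (λ i → least R′ i ∧ in-class-above-v i)
  bit-least-v with class-below-v in below
  ... | true  = trans (cong bit (trans least-v (cong not below))) (sym (countᶠ-false _ (no-least-above-v below)))
  ... | false = trans (cong bit (trans least-v (cong not below))) (sym (one-least-above-v below))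

  classCount-collapse : classCount R ≡ classCount R′
  classCount-collapse = begin
    countᶠ (least R)
      ≡⟨ countᶠ-punchIn v (least R) ⟩
    bit (least R v) + countᶠ (least R ∘ punchIn v)
      ≡⟨ cong₂ _+_ bit-least-v (countᶠ-cong least-punchIn) ⟩
    countᶠ (λ i → least R′ i ∧ in-class-above-v i)
      + countᶠ (λ i → least R′ i ∧ not (in-class-above-v i))
      ≡⟨ sym (countᶠ-split (least R′) in-class-above-v) ⟩
    countᶠ (least R′)
      ∎
    where open ≡-Reasoning

k≡classCount : ∀ {n} (A : List (Pair n)) → k A ≡ classCount (connected A)
k≡classCount {n} A =
  trans (length-filter-tabulate (λ y → not (any (below y) (allFin n))) (λ i → i))
        (countᶠ-cong λ y → cong not (any-tabulate (below y) (λ i → i)))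
  where
  below : Fin n → Fin n → Bool
  below y x = (x <ᵇ y) ∧ connected A x y

k-cong : ∀ {n} {A B : List (Pair n)} → SameAdjacency A B → k A ≡ k B
k-cong {n} {A} {B} A≈B = begin
  k A                         ≡⟨ k≡classCount A ⟩
  countᶠ (least (connected A)) ≡⟨ countᶠ-cong (λ y → cong not (anyᶠ-cong λ x →
                                   cong ((x <ᵇ y) ∧_) (reachN-cong A≈B n x y))) ⟩
  countᶠ (least (connected B)) ≡⟨ sym (k≡classCount B) ⟩
  k B                         ∎
  where open ≡-Reasoning

k-[] : ∀ n → k {n} [] ≡ n
k-[] n = begin
  k {n} []                      ≡⟨ k≡classCount {n} [] ⟩
  countᶠ (least (connected {n} [])) ≡⟨ countᶠ-cong (λ y → cong not (anyᶠ-false _ (isolated y))) ⟩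
  countᶠ {n} (λ _ → true)       ≡⟨ countᶠ-true n ⟩
  n                             ∎
  where
  open ≡-Reasoning
  reachN-[] : ∀ t (x y : Fin n) → reachN t [] x y ≡ (x == y)
  reachN-[] zero    x y = refl
  reachN-[] (suc t) x y = trans (𝔹.∨-identityʳ _) (reachN-[] t x y)
  isolated : ∀ y x → (x <ᵇ y) ∧ connected [] x y ≡ false
  isolated y x = ∧-false-intro _ _ λ x<y c →
    let x≡y = ==⇒≡ {x = x} {y} (trans (sym (reachN-[] n x y)) c) in
    true≢false (trans (sym x<y) (subst (λ z → (x <ᵇ z) ≡ false) x≡y (<ᵇ-irrefl x)))

-- Contracting an edge

mapPair : ∀ {n n′} → (Fin n → Fin n′) → Pair n → Pair n′
mapPair f (a , b) = f a , f b

links-map : ∀ {n n′} (f : Fin n → Fin n′) (p : Pair n) z y → links p z y ≡ true →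
            links (mapPair f p) (f z) (f y) ≡ true
links-map f p z y l with links-elim p z y l
... | inj₁ (refl , refl) = links-self (mapPair f p)
... | inj₂ (refl , refl) = links-self′ (mapPair f p)

adjacent-map : ∀ {n n′} (f : Fin n → Fin n′) (A : List (Pair n)) z y → adjacent A z y ≡ true →
               adjacent (map (mapPair f) A) (f z) (f y) ≡ true
adjacent-map f (p ∷ A) z y a with ∨-elim (links p z y) a
... | inj₁ l = ∨-introˡ _ (links-map f p z y l)
... | inj₂ r = ∨-introʳ (links (mapPair f p) (f z) (f y)) (adjacent-map f A z y r)

adjacent-map⁻ : ∀ {n n′} (f : Fin n → Fin n′) (A : List (Pair n)) c b →
                adjacent (map (mapPair f) A) c b ≡ true →
                ∃ λ y → ∃ λ z → f y ≡ c × f z ≡ b × adjacent A y z ≡ true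
adjacent-map⁻ f (p ∷ A) c b a with ∨-elim (links (mapPair f p) c b) a
... | inj₂ r = let y , z , fy , fz , ayz = adjacent-map⁻ f A c b r in
               y , z , fy , fz , ∨-introʳ (links p y z) ayz
... | inj₁ l with links-elim (mapPair f p) c b l
...   | inj₁ (fy , fz) = proj₁ p , proj₂ p , fy , fz , ∨-introˡ _ (links-self p)
...   | inj₂ (fy , fz) = proj₂ p , proj₁ p , fy , fz , ∨-introˡ _ (links-self′ p)

module Contraction {m : ℕ} (u v : Fin (suc m)) (v≢u : v ≢ u) where

  merge : Fin (suc m) → Fin m
  merge y with v Fin.≟ y
  ... | yes _  = punchOut v≢u
  ... | no v≢y = punchOut v≢y

  merge-v : merge v ≡ punchOut v≢u
  merge-v with v Fin.≟ v
  ... | yes _  = refl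
  ... | no v≢v = ⊥-elim (v≢v refl)

  merge-punchIn : ∀ i → merge (punchIn v i) ≡ i
  merge-punchIn i with v Fin.≟ punchIn v i
  ... | yes v≡i = ⊥-elim (Fin.punchInᵢ≢i v i (sym v≡i))
  ... | no _    = trans (Fin.punchOut-cong v refl) (Fin.punchOut-punchIn v)

  merge-u : merge u ≡ merge v
  merge-u = trans (subst (λ w → merge w ≡ punchOut v≢u) (Fin.punchIn-punchOut v≢u) (merge-punchIn _))
                  (sym merge-v)

  merge-injective : ∀ {y z} → y ≢ v → z ≢ v → merge y ≡ merge z → y ≡ z
  merge-injective {y} {z} y≢v z≢v eq with v Fin.≟ y | v Fin.≟ z
  ... | yes v≡y | _       = ⊥-elim (y≢v (sym v≡y))
  ... | no _    | yes v≡z = ⊥-elim (z≢v (sym v≡z))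
  ... | no v≢y  | no v≢z  = Fin.punchOut-injective v≢y v≢z eq

  merge-fibre : ∀ y → merge y ≡ merge v → y ≡ u ⊎ y ≡ v
  merge-fibre y eq with y Fin.≟ v
  ... | yes y≡v = inj₂ y≡v
  ... | no y≢v  = inj₁ (merge-injective y≢v (v≢u ∘ sym) (trans eq (sym merge-u)))

  merge-≡ : ∀ y z → merge y ≡ merge z → y ≡ z ⊎ (y ≡ u ⊎ y ≡ v) × (z ≡ u ⊎ z ≡ v)
  merge-≡ y z eq with y Fin.≟ v | z Fin.≟ v
  ... | yes refl | _        = inj₂ (inj₂ refl , merge-fibre z (sym eq))
  ... | no _     | yes refl = inj₂ (merge-fibre y eq , inj₂ refl)
  ... | no y≢v   | no z≢v   = inj₁ (merge-injective y≢v z≢v eq)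

  punchIn-merge : ∀ {y} → y ≢ v → punchIn v (merge y) ≡ y
  punchIn-merge {y} y≢v with v Fin.≟ y
  ... | yes v≡y = ⊥-elim (y≢v (sym v≡y))
  ... | no v≢y  = Fin.punchIn-punchOut v≢y

  merge-==-unmerged : ∀ a y → punchIn v a ≢ u → (merge y == a) ≡ (y == punchIn v a)
  merge-==-unmerged a y pa≢u = ==-ext
    (λ my≡a → ≡⇒== (to my≡a))
    (λ p → trans (cong merge (==⇒≡ p)) (merge-punchIn a))
    where
    to : merge y ≡ a → y ≡ punchIn v a
    to my≡a with y Fin.≟ v
    ... | yes refl =
      ⊥-elim (pa≢u (trans (cong (punchIn v) (trans (sym my≡a) merge-v)) (Fin.punchIn-punchOut v≢u)))
    ... | no y≢v   = trans (sym (punchIn-merge y≢v)) (cong (punchIn v) my≡a)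

  merge-==-merged : ∀ a y → punchIn v a ≡ u → (merge y == a) ≡ ((y == u) ∨ (y == v))
  merge-==-merged a y pa≡u = ==-ext
    (λ my≡a → [ ∨-introˡ _ ∘ ≡⇒== , ∨-introʳ (y == u) ∘ ≡⇒== ]
                (merge-fibre y (trans my≡a a≡mv)))
    (λ p → [ (λ q → trans (cong merge (==⇒≡ q)) (trans merge-u (sym a≡mv)))
           , (λ q → trans (cong merge (==⇒≡ q)) (sym a≡mv)) ] (∨-elim (y == u) p))
    where
    a≡mv : a ≡ merge v
    a≡mv = trans (sym (merge-punchIn a)) (trans (cong merge pa≡u) merge-u)

  module _ (X : List (Pair (suc m))) where

    uv∷X : List (Pair (suc m))
    uv∷X = (u , v) ∷ X

    X/uv : List (Pair m)
    X/uv = map (mapPair merge) X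

    module R⁺ = Reachability uv∷X
    module R⁻ = Reachability X/uv

    reach-merge : ∀ t x y → reachN t uv∷X x y ≡ true → reachN t X/uv (merge x) (merge y) ≡ true
    reach-merge zero    x y p rewrite ==⇒≡ {x = x} {y} p = ==-refl (merge y)
    reach-merge (suc t) x y p with R⁺.reach-suc-elim t x y p
    ... | inj₁ r = R⁻.reach-suc t _ _ (reach-merge t x y r)
    ... | inj₂ (w , r , a) with ∨-elim (links (u , v) w y) a
    ...   | inj₂ a′ = R⁻.reach-step t _ _ _ (reach-merge t x w r) (adjacent-map merge X w y a′)
    ...   | inj₁ l  = R⁻.reach-suc t _ _
                          (subst (λ s → reachN t X/uv (merge x) s ≡ true) (ends-merged l) (reach-merge t x w r))
      where
      ends-merged : links (u , v) w y ≡ true → merge w ≡ merge y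
      ends-merged l with links-elim (u , v) w y l
      ... | inj₁ (refl , refl) = merge-u
      ... | inj₂ (refl , refl) = sym merge-u

    u-v-connected : ∀ y z → y ≡ u ⊎ y ≡ v → z ≡ u ⊎ z ≡ v → connected uv∷X y z ≡ true
    u-v-connected y z (inj₁ refl) (inj₁ refl) = R⁺.connected-refl y
    u-v-connected y z (inj₁ refl) (inj₂ refl) =
      R⁺.adjacent⇒connected u v (∨-introˡ _ (links-self (u , v)))
    u-v-connected y z (inj₂ refl) (inj₁ refl) =
      R⁺.adjacent⇒connected v u (∨-introˡ _ (links-self′ (u , v)))
    u-v-connected y z (inj₂ refl) (inj₂ refl) = R⁺.connected-refl y

    merge-≡⇒connected : ∀ y z → merge y ≡ merge z → connected uv∷X y z ≡ true
    merge-≡⇒connected y z eq with merge-≡ y z eq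
    ... | inj₁ refl       = R⁺.connected-refl y
    ... | inj₂ (y∈ , z∈) = u-v-connected y z y∈ z∈

    reach-lift : ∀ t a b → reachN t X/uv a b ≡ true →
                 ∀ y z → merge y ≡ a → merge z ≡ b → connected uv∷X y z ≡ true
    reach-lift zero    a b p y z refl refl = merge-≡⇒connected y z (==⇒≡ p)
    reach-lift (suc t) a b p y z my mz with R⁻.reach-suc-elim t a b p
    ... | inj₁ r = reach-lift t a b r y z my mz
    ... | inj₂ (w , r , adj-wb) =
      let y′ , z′ , my′ , mz′ , a′ = adjacent-map⁻ merge X w b adj-wb in
      let y~y′ = reach-lift t a w r y y′ my my′
          y′~z′ = R⁺.adjacent⇒connected y′ z′ (∨-introʳ (links (u , v) y′ z′) a′)
          z′~z = merge-≡⇒connected z′ z (trans mz′ (sym mz))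
      in R⁺.connected-trans y z′ z (R⁺.connected-trans y y′ z′ y~y′ y′~z′) z′~z

    connected-merge : ∀ y z → connected uv∷X y z ≡ connected X/uv (merge y) (merge z)
    connected-merge y z = bool-ext (λ p → R⁻.saturate (suc m) _ _ (reach-merge (suc m) y z p))
                                   (λ p → reach-lift m _ _ p y z refl refl)

    k-contract : k uv∷X ≡ k X/uv
    k-contract = begin
      k uv∷X                      ≡⟨ k≡classCount uv∷X ⟩
      classCount (connected uv∷X) ≡⟨ classCount-collapse ⟩
      classCount (connected X/uv) ≡⟨ sym (k≡classCount X/uv) ⟩
      k X/uv                      ∎
      where
      open ≡-Reasoning
      open Collapse v merge merge-punchIn (connected uv∷X) (connected X/uv) connected-merge
                    R⁻.connected-refl R⁻.connected-sym R⁻.connected-trans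

-- Expanding the subset sum one edge at a time

sumℚ-++ : ∀ xs ys → sumℚ (xs ++ ys) ≡ sumℚ xs ℚ.+ sumℚ ys
sumℚ-++ []       ys = sym (ℚ.+-identityˡ _)
sumℚ-++ (x ∷ xs) ys = trans (cong (x ℚ.+_) (sumℚ-++ xs ys)) (sym (ℚ.+-assoc x _ _))

sumℚ-map-scale : ∀ {a} {X : Set a} r (f : X → ℚ) xs →
                 sumℚ (map (λ x → r ℚ.* f x) xs) ≡ r ℚ.* sumℚ (map f xs)
sumℚ-map-scale r f []       = sym (ℚ.*-zeroʳ r)
sumℚ-map-scale r f (x ∷ xs) =
  trans (cong (r ℚ.* f x ℚ.+_) (sumℚ-map-scale r f xs)) (sym (ℚ.*-distribˡ-+ r (f x) _))

sum-subsets-∷ : ∀ {a} {X : Set a} (f : List X → ℚ) x xs →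
                sumℚ (map f (subsets (x ∷ xs)))
                  ≡ sumℚ (map f (subsets xs)) ℚ.+ sumℚ (map (f ∘ (x ∷_)) (subsets xs))
sum-subsets-∷ f x xs = begin
  sumℚ (map f (subsets xs ++ map (x ∷_) (subsets xs)))
    ≡⟨ cong sumℚ (map-++ f (subsets xs) _) ⟩
  sumℚ (map f (subsets xs) ++ map f (map (x ∷_) (subsets xs)))
    ≡⟨ sumℚ-++ (map f (subsets xs)) _ ⟩
  sumℚ (map f (subsets xs)) ℚ.+ sumℚ (map f (map (x ∷_) (subsets xs)))
    ≡⟨ cong (λ ys → sumℚ (map f (subsets xs)) ℚ.+ sumℚ ys) (sym (map-∘ (subsets xs))) ⟩
  sumℚ (map f (subsets xs)) ℚ.+ sumℚ (map (f ∘ (x ∷_)) (subsets xs))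
    ∎
  where open ≡-Reasoning

module Expansion {n : ℕ} (q r : ℚ) where

  open +-*-Solver using (solve; _:+_; _:*_; _:=_)

  infixl 6 _+r·_
  _+r·_ : ℚ → ℚ → ℚ
  a +r· b = a ℚ.+ r ℚ.* b

  Zwith : List (Pair n) → List (Pair n) → ℚ
  Zwith []      P = q ^ℚ k P
  Zwith (x ∷ L) P = Zwith L P +r· Zwith L (x ∷ P)

  Zwith-cong : ∀ L {P P′} → SameAdjacency P P′ → Zwith L P ≡ Zwith L P′
  Zwith-cong []      P≈P′ = cong (q ^ℚ_) (k-cong P≈P′)
  Zwith-cong (x ∷ L) {P} {P′} P≈P′ =
    cong₂ _+r·_ (Zwith-cong L P≈P′) (Zwith-cong L (adjacent-∷-cong x {P} {P′} P≈P′))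

  subset-expansion : ∀ L P →
                     sumℚ (map (λ A → (q ^ℚ k (A ++ P)) ℚ.* (r ^ℚ length A)) (subsets L)) ≡ Zwith L P
  subset-expansion []      P = trans (ℚ.+-identityʳ _) (ℚ.*-identityʳ _)
  subset-expansion (x ∷ L) P = begin
    sumℚ (map term (subsets (x ∷ L)))
      ≡⟨ sum-subsets-∷ term x L ⟩
    sumℚ (map term (subsets L)) ℚ.+ sumℚ (map (term ∘ (x ∷_)) (subsets L))
      ≡⟨ cong₂ ℚ._+_ (subset-expansion L P) (cong sumℚ (map-cong move-x (subsets L))) ⟩
    Zwith L P ℚ.+ sumℚ (map (λ A → r ℚ.* term′ A) (subsets L))
      ≡⟨ cong (Zwith L P ℚ.+_) (sumℚ-map-scale r term′ (subsets L)) ⟩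
    Zwith L P +r· sumℚ (map term′ (subsets L))
      ≡⟨ cong (Zwith L P +r·_) (subset-expansion L (x ∷ P)) ⟩
    Zwith L P +r· Zwith L (x ∷ P)
      ∎
    where
    open ≡-Reasoning
    term term′ : List (Pair n) → ℚ
    term  A = (q ^ℚ k (A ++ P)) ℚ.* (r ^ℚ length A)
    term′ A = (q ^ℚ k (A ++ x ∷ P)) ℚ.* (r ^ℚ length A)
    move-x : ∀ A → term (x ∷ A) ≡ r ℚ.* term′ A
    move-x A = trans (cong (λ c → (q ^ℚ c) ℚ.* (r ℚ.* (r ^ℚ length A))) (k-cong (adjacent-move x A P)))
                     (solve 3 (λ a r b → a :* (r :* b) := r :* (a :* b)) refl
                            (q ^ℚ k (A ++ x ∷ P)) r (r ^ℚ length A))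

  Z≡Zwith : ∀ L → sumℚ (map (λ A → (q ^ℚ k A) ℚ.* (r ^ℚ length A)) (subsets L)) ≡ Zwith L []
  Z≡Zwith L = trans (cong sumℚ (map-cong without-[] (subsets L))) (subset-expansion L [])
    where
    without-[] : ∀ A → (q ^ℚ k A) ℚ.* (r ^ℚ length A) ≡ (q ^ℚ k (A ++ [])) ℚ.* (r ^ℚ length A)
    without-[] A = cong (λ B → (q ^ℚ k B) ℚ.* (r ^ℚ length A)) (sym (++-identityʳ A))

  Zwith-swap : ∀ x y L P → Zwith (x ∷ y ∷ L) P ≡ Zwith (y ∷ x ∷ L) P
  Zwith-swap x y L P = begin
    (Zwith L P +r· Zwith L (y ∷ P)) +r· (Zwith L (x ∷ P) +r· Zwith L (y ∷ x ∷ P))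
      ≡⟨ cong (λ d → (Zwith L P +r· Zwith L (y ∷ P)) +r· (Zwith L (x ∷ P) +r· d))
              (Zwith-cong L (adjacent-swap y x P)) ⟩
    (Zwith L P +r· Zwith L (y ∷ P)) +r· (Zwith L (x ∷ P) +r· Zwith L (x ∷ y ∷ P))
      ≡⟨ solve 5 (λ a b c d r → (a :+ r :* b) :+ r :* (c :+ r :* d) := (a :+ r :* c) :+ r :* (b :+ r :* d))
               refl
               (Zwith L P) (Zwith L (y ∷ P)) (Zwith L (x ∷ P)) (Zwith L (x ∷ y ∷ P)) r ⟩
    (Zwith L P +r· Zwith L (x ∷ P)) +r· (Zwith L (y ∷ P) +r· Zwith L (x ∷ y ∷ P))
      ∎
    where open ≡-Reasoning

  Zwith-↭ : ∀ {L L′} → L ↭ L′ → ∀ P → Zwith L P ≡ Zwith L′ P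
  Zwith-↭ ↭.refl              P = refl
  Zwith-↭ (↭.prep x L↭L′)     P = cong₂ _+r·_ (Zwith-↭ L↭L′ P) (Zwith-↭ L↭L′ (x ∷ P))
  Zwith-↭ (↭.swap {xs = L} {ys = L′} x y L↭L′) P =
    trans (Zwith-swap x y L P) (cong₂ _+r·_ (behind-x P) (behind-x (y ∷ P)))
    where
    behind-x : ∀ Q → Zwith (x ∷ L) Q ≡ Zwith (x ∷ L′) Q
    behind-x Q = cong₂ _+r·_ (Zwith-↭ L↭L′ Q) (Zwith-↭ L↭L′ (x ∷ Q))
  Zwith-↭ (↭.trans L↭M M↭L′) P = trans (Zwith-↭ L↭M P) (Zwith-↭ M↭L′ P)

  Zwith-head : ∀ {x x′} → SameLinks x x′ → ∀ L P → Zwith (x ∷ L) P ≡ Zwith (x′ ∷ L) P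
  Zwith-head {x} {x′} x≈x′ L P = cong (Zwith L P +r·_) (Zwith-cong L (adjacent-head {x = x} {x′} x≈x′ P))

  -- The subsets containing neither, one or both of two copies of an edge carry the weights 1, 2r and r²,
  -- and the connectivity is the same whenever at least one copy is present.
  Zwith-double : r ℚ.+ (r ℚ.+ r ℚ.* r) ≡ 0ℚ → ∀ {x x′} → SameLinks x x′ → ∀ L P →
                 Zwith (x ∷ x′ ∷ L) P ≡ Zwith L P
  Zwith-double 2r+r²≡0 {x} {x′} x≈x′ L P = begin
    (Zwith L P +r· Zwith L (x′ ∷ P)) +r· (Zwith L (x ∷ P) +r· Zwith L (x′ ∷ x ∷ P))
      ≡⟨ cong₂ (λ b c → (Zwith L P +r· b) +r· (Zwith L (x ∷ P) +r· c))
               (Zwith-cong L (adjacent-head {x = x′} {x} x′≈x P))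
               (Zwith-cong L (λ z y → trans (adjacent-head {x = x′} {x} x′≈x (x ∷ P) z y)
                                            (adjacent-dup x P z y))) ⟩
    (Zwith L P +r· Zwith L (x ∷ P)) +r· (Zwith L (x ∷ P) +r· Zwith L (x ∷ P))
      ≡⟨ solve 3 (λ a b r → (a :+ r :* b) :+ r :* (b :+ r :* b) := a :+ (r :+ (r :+ r :* r)) :* b) refl
               (Zwith L P) (Zwith L (x ∷ P)) r ⟩
    Zwith L P ℚ.+ (r ℚ.+ (r ℚ.+ r ℚ.* r)) ℚ.* Zwith L (x ∷ P)
      ≡⟨ cong (λ c → Zwith L P ℚ.+ c ℚ.* Zwith L (x ∷ P)) 2r+r²≡0 ⟩
    Zwith L P ℚ.+ 0ℚ ℚ.* Zwith L (x ∷ P)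
      ≡⟨ cong (Zwith L P ℚ.+_) (ℚ.*-zeroˡ (Zwith L (x ∷ P))) ⟩
    Zwith L P ℚ.+ 0ℚ
      ≡⟨ ℚ.+-identityʳ _ ⟩
    Zwith L P
      ∎
    where
    open ≡-Reasoning
    x′≈x : SameLinks x′ x
    x′≈x z y = sym (x≈x′ z y)

-- Parity of edge multiplicities

xorˡ : ∀ {a} {X : Set a} → (X → Bool) → List X → Bool
xorˡ f []       = false
xorˡ f (x ∷ xs) = f x xor xorˡ f xs

parity : ∀ {n} → List (Pair n) → Fin n → Fin n → Bool
parity L a b = xorˡ (λ p → links p a b) L

SameParity : ∀ {n} → List (Pair n) → List (Pair n) → Set
SameParity L L′ = ∀ a b → parity L a b ≡ parity L′ a b

parity-↭ : ∀ {n} {L L′ : List (Pair n)} → L ↭ L′ → SameParity L L′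
parity-↭ ↭.refl              a b = refl
parity-↭ (↭.prep p L↭L′)     a b = cong (links p a b xor_) (parity-↭ L↭L′ a b)
parity-↭ (↭.swap p p′ L↭L′)  a b =
  trans (xor-swap (links p a b) (links p′ a b) _)
        (cong (λ c → links p′ a b xor (links p a b xor c)) (parity-↭ L↭L′ a b))
parity-↭ (↭.trans L↭M M↭L′) a b = trans (parity-↭ L↭M a b) (parity-↭ M↭L′ a b)

parity⇒adjacent : ∀ {n} (L : List (Pair n)) a b → parity L a b ≡ true → adjacent L a b ≡ true
parity⇒adjacent (p ∷ L) a b h with links p a b
... | true  = refl
... | false = parity⇒adjacent L a b h

¬adjacent⇒parity-false : ∀ {n} (L : List (Pair n)) a b → adjacent L a b ≡ false → parity L a b ≡ false
¬adjacent⇒parity-false []      a b h = refl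
¬adjacent⇒parity-false (p ∷ L) a b h with links p a b
... | false = ¬adjacent⇒parity-false L a b h

same-links : ∀ {n} (x x′ : Pair n) → links x′ (proj₁ x) (proj₂ x) ≡ true → SameLinks x x′
same-links x x′ l z y with links-elim x′ (proj₁ x) (proj₂ x) l
... | inj₁ (refl , refl) = refl
... | inj₂ (refl , refl) = 𝔹.∨-comm ((proj₁ x == z) ∧ (proj₂ x == y)) _

pull-out : ∀ {n} (x : Pair n) L → adjacent L (proj₁ x) (proj₂ x) ≡ true →
           ∃ λ x′ → ∃ λ L₁ → SameLinks x x′ × L ↭ x′ ∷ L₁
pull-out x (p ∷ L) a with links p (proj₁ x) (proj₂ x) in l
... | true  = p , L , same-links x p l , ↭.refl
... | false = let x′ , L₁ , x≈x′ , L↭ = pull-out x L a in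
              x′ , p ∷ L₁ , x≈x′ , ↭.trans (↭.prep p L↭) (↭.swap p x′ ↭.refl)

-- When (1 + r)² = 1, Zwith L only depends on the multiplicities of the edges of L modulo 2.
module ParityInvariance {n : ℕ} (q r : ℚ) (2r+r²≡0 : r ℚ.+ (r ℚ.+ r ℚ.* r) ≡ 0ℚ) where

  open Expansion {n} q r

  pair-off : ∀ x L → parity (x ∷ L) (proj₁ x) (proj₂ x) ≡ false →
             ∃ λ L₂ → suc (length L₂) ≡ length L × SameParity (x ∷ L) L₂
                      × (∀ P → Zwith (x ∷ L) P ≡ Zwith L₂ P)
  pair-off x L even =
    let x″ , L₂ , x≈x″ , L↭ = pull-out x L (parity⇒adjacent L _ _ odd)
        same-parity : SameParity (x ∷ L) L₂
        same-parity a b = begin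
          links x a b xor parity L a b                      ≡⟨ cong₂ _xor_ (x≈x″ a b) (parity-↭ L↭ a b) ⟩
          links x″ a b xor (links x″ a b xor parity L₂ a b) ≡⟨ xor-cancel (links x″ a b) _ ⟩
          parity L₂ a b                                     ∎
    in L₂ , sym (↭.↭-length L↭) , same-parity ,
       λ P → trans (Zwith-↭ (↭.prep x L↭) P) (Zwith-double 2r+r²≡0 x≈x″ L₂ P)
    where
    open ≡-Reasoning
    odd : parity L (proj₁ x) (proj₂ x) ≡ true
    odd = 𝔹.not-injective (trans (cong (_xor parity L (proj₁ x) (proj₂ x)) (sym (links-self x))) even)

  Zwith-parity : ∀ N L L′ → length L + length L′ ≤ N → SameParity L L′ →
                 ∀ P → Zwith L P ≡ Zwith L′ P
  Zwith-parity N       []      []       _ _ P = refl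
  Zwith-parity (suc N) []      (y ∷ L′) (s≤s ≤N) L≈L′ P =
    let L₂ , len , y∷L′≈L₂ , Zy∷L′≡L₂ = pair-off y L′ (sym (L≈L′ (proj₁ y) (proj₂ y))) in
    trans (Zwith-parity N [] L₂ (ℕ.≤-trans (ℕ.n≤1+n _) (subst (_≤ N) (sym len) ≤N))
                        (λ a b → trans (L≈L′ a b) (y∷L′≈L₂ a b)) P)
          (sym (Zy∷L′≡L₂ P))
  Zwith-parity (suc N) (x ∷ L) L′ (s≤s ≤N) L≈L′ P =
    [ shared , unshared ]′ (true-or-false (adjacent L′ (proj₁ x) (proj₂ x)))
    where
    open ≡-Reasoning
    shared : adjacent L′ (proj₁ x) (proj₂ x) ≡ true → Zwith (x ∷ L) P ≡ Zwith L′ P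
    shared occurs =
      let x′ , L₁′ , x≈x′ , L′↭ = pull-out x L′ occurs
          L≈L₁′ : SameParity L L₁′
          L≈L₁′ a b = begin
            parity L a b                            ≡⟨ sym (xor-cancel (links x a b) _) ⟩
            links x a b xor parity (x ∷ L) a b      ≡⟨ cong₂ _xor_ (x≈x′ a b)
                                                                   (trans (L≈L′ a b) (parity-↭ L′↭ a b)) ⟩
            links x′ a b xor parity (x′ ∷ L₁′) a b  ≡⟨ xor-cancel (links x′ a b) _ ⟩
            parity L₁′ a b                          ∎
          IH : ∀ Q → Zwith L Q ≡ Zwith L₁′ Q
          IH = Zwith-parity N L L₁′ (ℕ.≤-trans (ℕ.+-monoʳ-≤ (length L) (ℕ.n≤1+n _))
                                               (subst (λ l → length L + l ≤ N) (↭.↭-length L′↭) ≤N)) L≈L₁′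
      in begin
      Zwith L P +r· Zwith L (x ∷ P)        ≡⟨ cong₂ _+r·_ (IH P) (IH (x ∷ P)) ⟩
      Zwith (x ∷ L₁′) P                     ≡⟨ Zwith-head x≈x′ L₁′ P ⟩
      Zwith (x′ ∷ L₁′) P                    ≡⟨ sym (Zwith-↭ L′↭ P) ⟩
      Zwith L′ P                            ∎
    unshared : adjacent L′ (proj₁ x) (proj₂ x) ≡ false → Zwith (x ∷ L) P ≡ Zwith L′ P
    unshared absent =
      let even = trans (L≈L′ (proj₁ x) (proj₂ x)) (¬adjacent⇒parity-false L′ _ _ absent)
          L₂ , len , x∷L≈L₂ , Zx∷L≡L₂ = pair-off x L even
      in trans (Zx∷L≡L₂ P)
               (Zwith-parity N L₂ L′ (ℕ.≤-trans (ℕ.n≤1+n _)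
                                                (subst (λ l → l + length L′ ≤ N) (sym len) ≤N))
                                     (λ a b → trans (sym (x∷L≈L₂ a b)) (L≈L′ a b)) P)

Zwith-contract : ∀ {m} (u v : Fin (suc m)) (v≢u : v ≢ u) (q r : ℚ) L P →
  let open Contraction u v v≢u in
  Expansion.Zwith q r L ((u , v) ∷ P)
    ≡ Expansion.Zwith q r (map (mapPair merge) L) (map (mapPair merge) P)
Zwith-contract u v v≢u q r []      P = cong (q ^ℚ_) (Contraction.k-contract u v v≢u P)
Zwith-contract u v v≢u q r (x ∷ L) P =
  cong₂ (λ a b → a ℚ.+ r ℚ.* b) (Zwith-contract u v v≢u q r L P)
        (trans (Expansion.Zwith-cong q r L (adjacent-swap x (u , v) P))
               (Zwith-contract u v v≢u q r L (x ∷ P)))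

xorᶠ : ∀ {n} → (Fin n → Bool) → Bool
xorᶠ {zero}  f = false
xorᶠ {suc n} f = f Fin.zero xor xorᶠ (f ∘ Fin.suc)

xorᶠ-cong : ∀ {n} {f g : Fin n → Bool} → (∀ i → f i ≡ g i) → xorᶠ f ≡ xorᶠ g
xorᶠ-cong {zero}  h = refl
xorᶠ-cong {suc n} h = cong₂ _xor_ (h Fin.zero) (xorᶠ-cong (h ∘ Fin.suc))

xorᶠ-xor : ∀ {n} (f g : Fin n → Bool) → xorᶠ (λ i → f i xor g i) ≡ xorᶠ f xor xorᶠ g
xorᶠ-xor {zero}  f g = refl
xorᶠ-xor {suc n} f g = trans (cong ((f Fin.zero xor g Fin.zero) xor_) (xorᶠ-xor (f ∘ Fin.suc) (g ∘ Fin.suc)))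
                             (xor-interchange (f Fin.zero) (g Fin.zero) _ _)

xorᶠ-false : ∀ n → xorᶠ {n} (λ _ → false) ≡ false
xorᶠ-false zero    = refl
xorᶠ-false (suc n) = xorᶠ-false n

xorᶠ-∧ : ∀ {n} c (f : Fin n → Bool) → xorᶠ (λ i → c ∧ f i) ≡ c ∧ xorᶠ f
xorᶠ-∧ {n} false f = xorᶠ-false n
xorᶠ-∧     true  f = refl

xorᶠ-punchIn : ∀ {m} (w : Fin (suc m)) (f : Fin (suc m) → Bool) →
               xorᶠ f ≡ f w xor xorᶠ (f ∘ punchIn w)
xorᶠ-punchIn Fin.zero f = refl
xorᶠ-punchIn {suc m} (Fin.suc w) f =
  trans (cong (f Fin.zero xor_) (xorᶠ-punchIn w (f ∘ Fin.suc))) (xor-swap (f Fin.zero) (f (Fin.suc w)) _)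

xorᶠ-== : ∀ {n} (c : Fin n) (f : Fin n → Bool) → xorᶠ (λ z → (z == c) ∧ f z) ≡ f c
xorᶠ-== {suc m} c f = begin
  xorᶠ (λ z → (z == c) ∧ f z)
    ≡⟨ xorᶠ-punchIn c (λ z → (z == c) ∧ f z) ⟩
  ((c == c) ∧ f c) xor xorᶠ (λ j → (punchIn c j == c) ∧ f (punchIn c j))
    ≡⟨ cong₂ _xor_ (cong (_∧ f c) (==-refl c))
                   (trans (xorᶠ-cong λ j → cong (_∧ f (punchIn c j)) (≢⇒==-false (Fin.punchInᵢ≢i c j)))
                          (xorᶠ-false m)) ⟩
  f c xor false
    ≡⟨ 𝔹.xor-identityʳ (f c) ⟩
  f c
    ∎
  where open ≡-Reasoning

xorˡ-++ : ∀ {a} {X : Set a} (f : X → Bool) xs ys → xorˡ f (xs ++ ys) ≡ xorˡ f xs xor xorˡ f ys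
xorˡ-++ f []       ys = refl
xorˡ-++ f (x ∷ xs) ys = trans (cong (f x xor_) (xorˡ-++ f xs ys)) (sym (𝔹.xor-assoc (f x) _ _))

xorˡ-concat : ∀ {a} {X : Set a} (f : X → Bool) xss → xorˡ f (concat xss) ≡ xorˡ (xorˡ f) xss
xorˡ-concat f []         = refl
xorˡ-concat f (xs ∷ xss) = trans (xorˡ-++ f xs (concat xss)) (cong (xorˡ f xs xor_) (xorˡ-concat f xss))

xorˡ-map : ∀ {a b} {X : Set a} {Y : Set b} (f : Y → Bool) (g : X → Y) xs →
           xorˡ f (map g xs) ≡ xorˡ (f ∘ g) xs
xorˡ-map f g []       = refl
xorˡ-map f g (x ∷ xs) = cong (f (g x) xor_) (xorˡ-map f g xs)

xorˡ-filter : ∀ {a p} {X : Set a} {P : Pred X p} (P? : Decidable P) (f : X → Bool) xs →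
              xorˡ f (filter P? xs) ≡ xorˡ (λ x → does (P? x) ∧ f x) xs
xorˡ-filter P? f []       = refl
xorˡ-filter P? f (x ∷ xs) with does (P? x)
... | true  = cong (f x xor_) (xorˡ-filter P? f xs)
... | false = xorˡ-filter P? f xs

xorˡ-tabulate : ∀ {a} {X : Set a} {n} (f : X → Bool) (g : Fin n → X) →
                xorˡ f (tabulate g) ≡ xorᶠ (f ∘ g)
xorˡ-tabulate {n = zero}  f g = refl
xorˡ-tabulate {n = suc n} f g = cong (f (g Fin.zero) xor_) (xorˡ-tabulate f (g ∘ Fin.suc))

xorˡ-pairs : ∀ n (f : Pair n → Bool) →
             xorˡ f (pairs n) ≡ xorᶠ (λ i → xorᶠ (λ j → (i <ᵇ j) ∧ f (i , j)))
xorˡ-pairs n f = begin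
  xorˡ f (concat (map row (allFin n)))  ≡⟨ xorˡ-concat f (map row (allFin n)) ⟩
  xorˡ (xorˡ f) (map row (allFin n))    ≡⟨ xorˡ-map (xorˡ f) row (allFin n) ⟩
  xorˡ (xorˡ f ∘ row) (allFin n)        ≡⟨ xorˡ-tabulate (xorˡ f ∘ row) (λ i → i) ⟩
  xorᶠ (xorˡ f ∘ row)                   ≡⟨ xorᶠ-cong row-sum ⟩
  xorᶠ (λ i → xorᶠ (λ j → (i <ᵇ j) ∧ f (i , j))) ∎
  where
  open ≡-Reasoning
  after : Fin n → Fin n → Set
  after i j = toℕ i < toℕ j
  after? : ∀ i → Decidable (after i)
  after? i j = toℕ i ℕ.<? toℕ j
  row-sum : ∀ i → xorˡ f (map (i ,_) (filter (after? i) (allFin n))) ≡ xorᶠ (λ j → (i <ᵇ j) ∧ f (i , j))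
  row-sum i = begin
    xorˡ f (map (i ,_) (filter (after? i) (allFin n)))    ≡⟨ xorˡ-map f (i ,_) (filter (after? i) (allFin n)) ⟩
    xorˡ (λ j → f (i , j)) (filter (after? i) (allFin n)) ≡⟨ xorˡ-filter (after? i) (λ j → f (i , j)) (allFin n) ⟩
    xorˡ (λ j → (i <ᵇ j) ∧ f (i , j)) (allFin n)          ≡⟨ xorˡ-tabulate (λ j → (i <ᵇ j) ∧ f (i , j)) (λ j → j) ⟩
    xorᶠ (λ j → (i <ᵇ j) ∧ f (i , j))                     ∎
  row : Fin n → List (Pair n)
  row i = map (i ,_) (filter (after? i) (allFin n))

parity-edges : ∀ {n} (H : Graph n) a b → parity (edges H) a b ≡ adj H a b
parity-edges {n} H a b = begin
  xorˡ (λ p → links p a b) (filter (T? ∘ adjacentPair) (pairs n))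
    ≡⟨ xorˡ-filter (T? ∘ adjacentPair) (λ p → links p a b) (pairs n) ⟩
  xorˡ (λ p → adjacentPair p ∧ links p a b) (pairs n)
    ≡⟨ xorˡ-pairs n (λ p → adjacentPair p ∧ links p a b) ⟩
  xorᶠ (λ i → xorᶠ (λ j → (i <ᵇ j) ∧ (adj H i j ∧ links (i , j) a b)))
    ≡⟨ xorᶠ-cong (λ i → xorᶠ-cong (split i)) ⟩
  xorᶠ (λ i → xorᶠ (λ j → at a b i j xor at b a i j))
    ≡⟨ xorᶠ-cong (λ i → xorᶠ-xor (at a b i) (at b a i)) ⟩
  xorᶠ (λ i → xorᶠ (at a b i) xor xorᶠ (at b a i))
    ≡⟨ xorᶠ-xor (λ i → xorᶠ (at a b i)) (λ i → xorᶠ (at b a i)) ⟩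
  xorᶠ (λ i → xorᶠ (at a b i)) xor xorᶠ (λ i → xorᶠ (at b a i))
    ≡⟨ cong₂ _xor_ (pick a b) (pick b a) ⟩
  g a b xor g b a
    ≡⟨ ordered ⟩
  adj H a b
    ∎
  where
  open ≡-Reasoning
  adjacentPair : Pair n → Bool
  adjacentPair p = adj H (proj₁ p) (proj₂ p)
  g : Fin n → Fin n → Bool
  g i j = (i <ᵇ j) ∧ adj H i j
  at : Fin n → Fin n → Fin n → Fin n → Bool
  at c d i j = g i j ∧ ((i == c) ∧ (j == d))
  split : ∀ i j → (i <ᵇ j) ∧ (adj H i j ∧ links (i , j) a b) ≡ at a b i j xor at b a i j
  split i j = begin
    (i <ᵇ j) ∧ (adj H i j ∧ links (i , j) a b)       ≡⟨ sym (𝔹.∧-assoc (i <ᵇ j) (adj H i j) _) ⟩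
    g i j ∧ (ia∧jb ∨ ((j == a) ∧ (i == b)))          ≡⟨ ∧-∨≡∧-xor (g i j) ia∧jb _ one-orientation ⟩
    g i j ∧ (ia∧jb xor ((j == a) ∧ (i == b)))        ≡⟨ 𝔹.∧-distribˡ-xor (g i j) ia∧jb _ ⟩
    at a b i j xor (g i j ∧ ((j == a) ∧ (i == b)))   ≡⟨ cong (λ c → at a b i j xor (g i j ∧ c))
                                                             (𝔹.∧-comm (j == a) _) ⟩
    at a b i j xor at b a i j                        ∎
    where
    ia∧jb = (i == a) ∧ (j == b)
    one-orientation : g i j ≡ true → ia∧jb ≡ true → (j == a) ∧ (i == b) ≡ true → ⊥
    one-orientation gij ab ba =
      let i≡a = ==⇒≡ {x = i} {a} (∧-elimˡ (i == a) ab)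
          j≡a = ==⇒≡ {x = j} {a} (∧-elimˡ (j == a) ba)
      in ℕ.<-irrefl (cong toℕ (trans i≡a (sym j≡a))) (<ᵇ⇒< {x = i} {j} (∧-elimˡ (i <ᵇ j) gij))
  rearrange : ∀ c x y → c ∧ (x ∧ y) ≡ x ∧ (y ∧ c)
  rearrange c false y = 𝔹.∧-zeroʳ c
  rearrange c true  y = 𝔹.∧-comm c y
  pick : ∀ c d → xorᶠ (λ i → xorᶠ (at c d i)) ≡ g c d
  pick c d = trans (xorᶠ-cong (λ i → trans (xorᶠ-cong (λ j → rearrange (g i j) (i == c) (j == d)))
                                    (trans (xorᶠ-∧ (i == c) (λ j → (j == d) ∧ g i j))
                                           (cong ((i == c) ∧_) (xorᶠ-== d (g i))))))
                   (xorᶠ-== c (λ i → g i d))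
  ordered : g a b xor g b a ≡ adj H a b
  ordered with ℕ.<-cmp (toℕ a) (toℕ b)
  ... | tri< a<b _ b≮a rewrite <⇒<ᵇ {x = a} {b} a<b | ≮⇒<ᵇ-false {x = b} {a} b≮a = 𝔹.xor-identityʳ _
  ... | tri≈ _ a≡b _   rewrite Fin.toℕ-injective a≡b | <ᵇ-irrefl b                 = sym (irrefl H b)
  ... | tri> a≮b _ b<a rewrite <⇒<ᵇ {x = b} {a} b<a | ≮⇒<ᵇ-false {x = a} {b} a≮b = symm H b a

-- Deleting and contracting an edge of a graph

xorˡ-cong : ∀ {a} {X : Set a} {f g : X → Bool} → (∀ x → f x ≡ g x) → ∀ xs → xorˡ f xs ≡ xorˡ g xs
xorˡ-cong h []       = refl
xorˡ-cong h (x ∷ xs) = cong₂ _xor_ (h x) (xorˡ-cong h xs)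

xorˡ-xor : ∀ {a} {X : Set a} (f g : X → Bool) xs → xorˡ (λ x → f x xor g x) xs ≡ xorˡ f xs xor xorˡ g xs
xorˡ-xor f g []       = refl
xorˡ-xor f g (x ∷ xs) = trans (cong ((f x xor g x) xor_) (xorˡ-xor f g xs)) (xor-interchange (f x) (g x) _ _)

LoopFree : ∀ {n} → List (Pair n) → Set
LoopFree = All (λ p → proj₁ p ≢ proj₂ p)

parity-diagonal : ∀ {n} {L : List (Pair n)} → LoopFree L → ∀ a → parity L a a ≡ false
parity-diagonal {L = []}    []          a = refl
parity-diagonal {L = p ∷ L} (p≢ ∷ free) a = cong₂ _xor_ no-loop (parity-diagonal free a)
  where
  no-loop : links p a a ≡ false
  no-loop with links p a a in l
  ... | false = refl
  ... | true with links-elim p a a l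
  ...   | inj₁ (refl , p₂≡a) = ⊥-elim (p≢ (sym p₂≡a))
  ...   | inj₂ (p₂≡a , refl) = ⊥-elim (p≢ (sym p₂≡a))

data AtMostOne : Bool → Bool → Bool → Set where
  first  : AtMostOne true  false false
  second : AtMostOne false true  false
  third  : AtMostOne false false true
  none   : AtMostOne false false false

at-most-one : ∀ {n} (y x₁ x₂ x₃ : Fin n) → x₁ ≢ x₂ → x₁ ≢ x₃ → x₂ ≢ x₃ →
              AtMostOne (y == x₁) (y == x₂) (y == x₃)
at-most-one y x₁ x₂ x₃ x₁≢x₂ x₁≢x₃ x₂≢x₃ with y Fin.≟ x₁ | y Fin.≟ x₂ | y Fin.≟ x₃
... | yes refl | yes refl | _        = ⊥-elim (x₁≢x₂ refl)
... | yes refl | no _     | yes refl = ⊥-elim (x₁≢x₃ refl)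
... | yes _    | no _     | no _     = first
... | no _     | yes refl | yes refl = ⊥-elim (x₂≢x₃ refl)
... | no _     | yes _    | no _     = second
... | no _     | no _     | yes _    = third
... | no _     | no _     | no _     = none

-- αᵢ, βᵢ, γᵢ say whether the i-th end of a pair is u, v or c; the pair joins the merged vertex {u, v} to c
-- iff it joins exactly one of u and v to c.
merged-links : ∀ {α₁ β₁ γ₁ α₂ β₂ γ₂} → AtMostOne α₁ β₁ γ₁ → AtMostOne α₂ β₂ γ₂ →
               ((α₁ ∨ β₁) ∧ γ₂) ∨ ((α₂ ∨ β₂) ∧ γ₁) ≡ ((α₁ ∧ γ₂) ∨ (α₂ ∧ γ₁)) xor ((β₁ ∧ γ₂) ∨ (β₂ ∧ γ₁))
merged-links first  first  = refl
merged-links first  second = refl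
merged-links first  third  = refl
merged-links first  none   = refl
merged-links second first  = refl
merged-links second second = refl
merged-links second third  = refl
merged-links second none   = refl
merged-links third  first  = refl
merged-links third  second = refl
merged-links third  third  = refl
merged-links third  none   = refl
merged-links none   first  = refl
merged-links none   second = refl
merged-links none   third  = refl
merged-links none   none   = refl

module DeletionContraction {m : ℕ} (G : Graph (suc m)) (e : Edge G) where

  v≢u : v e ≢ u e
  v≢u v≡u = true≢false (trans (sym (isEdge e)) (trans (cong (adj G (u e)) v≡u) (irrefl G (u e))))

  open Contraction (u e) (v e) v≢u

  edgeMatch-away : ∀ x {y} → y ≢ u e → y ≢ v e → edgeMatch (u e) (v e) x y ≡ false
  edgeMatch-away x y≢u y≢v rewrite ≢⇒==-false y≢u | ≢⇒==-false y≢v =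
    cong₂ _∨_ (𝔹.∧-zeroʳ (x == u e)) (𝔹.∧-zeroʳ (x == v e))

  adj-─-away : ∀ x {y} → y ≢ u e → y ≢ v e → adj (G ─ e) x y ≡ adj G x y
  adj-─-away x {y} y≢u y≢v rewrite edgeMatch-away x y≢u y≢v = 𝔹.∧-identityʳ (adj G x y)

  links≡edgeMatch : ∀ a b → links (u e , v e) a b ≡ edgeMatch (u e) (v e) a b
  links≡edgeMatch a b = cong₂ _∨_ (cong₂ _∧_ (==-sym (u e) a) (==-sym (v e) b))
                                  (cong₂ _∧_ (==-sym (v e) a) (==-sym (u e) b))

  edgeMatch⇒adj : ∀ a b → edgeMatch (u e) (v e) a b ≡ true → adj G a b ≡ true
  edgeMatch⇒adj a b m with links-elim (u e , v e) a b (trans (links≡edgeMatch a b) m)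
  ... | inj₁ (refl , refl) = isEdge e
  ... | inj₂ (refl , refl) = trans (symm G (v e) (u e)) (isEdge e)

  deletion-parity : SameParity (edges G) ((u e , v e) ∷ edges (G ─ e))
  deletion-parity a b = begin
    parity (edges G) a b
      ≡⟨ parity-edges G a b ⟩
    adj G a b
      ≡⟨ restore (edgeMatch (u e) (v e) a b) (adj G a b) (edgeMatch⇒adj a b) ⟩
    edgeMatch (u e) (v e) a b xor adj (G ─ e) a b
      ≡⟨ cong₂ _xor_ (sym (links≡edgeMatch a b)) (sym (parity-edges (G ─ e) a b)) ⟩
    links (u e , v e) a b xor parity (edges (G ─ e)) a b
      ∎
    where
    open ≡-Reasoning
    restore : ∀ c d → (c ≡ true → d ≡ true) → d ≡ c xor (d ∧ not c)
    restore false d _  = sym (𝔹.∧-identityʳ d)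
    restore true  d c⇒d rewrite c⇒d refl = refl

  contracted : List (Pair m)
  contracted = map (mapPair merge) (edges (G ─ e))

  removed-edge : ∀ y z → y ≡ u e ⊎ y ≡ v e → z ≡ u e ⊎ z ≡ v e → adj (G ─ e) y z ≡ false
  removed-edge _ _ (inj₁ refl) (inj₁ refl) = irrefl (G ─ e) (u e)
  removed-edge _ _ (inj₂ refl) (inj₂ refl) = irrefl (G ─ e) (v e)
  removed-edge _ _ (inj₁ refl) (inj₂ refl)
    rewrite sym (links≡edgeMatch (u e) (v e)) | links-self (u e , v e) = 𝔹.∧-zeroʳ (adj G (u e) (v e))
  removed-edge _ _ (inj₂ refl) (inj₁ refl)
    rewrite sym (links≡edgeMatch (v e) (u e)) | links-self′ (u e , v e) = 𝔹.∧-zeroʳ (adj G (v e) (u e))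

  merged-non-adjacent : ∀ y z → merge y ≡ merge z → adj (G ─ e) y z ≡ false
  merged-non-adjacent y z eq with merge-≡ y z eq
  ... | inj₁ refl       = irrefl (G ─ e) y
  ... | inj₂ (y∈ , z∈) = removed-edge y z y∈ z∈

  contracted-loopFree : LoopFree contracted
  contracted-loopFree = All.map⁺ (All.map no-loop (All.all-filter (T? ∘ adjacentPair) (pairs (suc m))))
    where
    adjacentPair : Pair (suc m) → Bool
    adjacentPair p = adj (G ─ e) (proj₁ p) (proj₂ p)
    no-loop : ∀ {p} → T (adjacentPair p) → merge (proj₁ p) ≢ merge (proj₂ p)
    no-loop {y , z} edge eq = subst T (merged-non-adjacent y z eq) edge

  parity-contracted-merged : ∀ a b → punchIn (v e) a ≡ u e → punchIn (v e) b ≢ u e →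
    parity contracted a b ≡ adj G (u e) (punchIn (v e) b) xor adj G (v e) (punchIn (v e) b)
  parity-contracted-merged a b pa≡u pb≢u = begin
    xorˡ (λ p → links p a b) (map (mapPair merge) (edges (G ─ e)))
      ≡⟨ xorˡ-map (λ p → links p a b) (mapPair merge) (edges (G ─ e)) ⟩
    xorˡ (λ p → links (mapPair merge p) a b) (edges (G ─ e))
      ≡⟨ xorˡ-cong split (edges (G ─ e)) ⟩
    xorˡ (λ p → links p (u e) pb xor links p (v e) pb) (edges (G ─ e))
      ≡⟨ xorˡ-xor (λ p → links p (u e) pb) (λ p → links p (v e) pb) (edges (G ─ e)) ⟩
    parity (edges (G ─ e)) (u e) pb xor parity (edges (G ─ e)) (v e) pb
      ≡⟨ cong₂ _xor_ (trans (parity-edges (G ─ e) (u e) pb) (adj-─-away (u e) pb≢u pb≢v))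
                     (trans (parity-edges (G ─ e) (v e) pb) (adj-─-away (v e) pb≢u pb≢v)) ⟩
    adj G (u e) pb xor adj G (v e) pb
      ∎
    where
    open ≡-Reasoning
    pb = punchIn (v e) b
    pb≢v : pb ≢ v e
    pb≢v = Fin.punchInᵢ≢i (v e) b
    classify : ∀ y → AtMostOne (y == u e) (y == v e) (y == pb)
    classify y = at-most-one y (u e) (v e) pb (v≢u ∘ sym) (pb≢u ∘ sym) (pb≢v ∘ sym)
    split : ∀ p → links (mapPair merge p) a b ≡ links p (u e) pb xor links p (v e) pb
    split (y , z) rewrite merge-==-merged a y pa≡u | merge-==-merged a z pa≡u
                        | merge-==-unmerged b y pb≢u | merge-==-unmerged b z pb≢u =
      merged-links (classify y) (classify z)

  parity-contracted-unmerged : ∀ a b → punchIn (v e) a ≢ u e → punchIn (v e) b ≢ u e →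
    parity contracted a b ≡ adj G (punchIn (v e) a) (punchIn (v e) b)
  parity-contracted-unmerged a b pa≢u pb≢u = begin
    xorˡ (λ p → links p a b) (map (mapPair merge) (edges (G ─ e)))
      ≡⟨ xorˡ-map (λ p → links p a b) (mapPair merge) (edges (G ─ e)) ⟩
    xorˡ (λ p → links (mapPair merge p) a b) (edges (G ─ e))
      ≡⟨ xorˡ-cong unmerge (edges (G ─ e)) ⟩
    parity (edges (G ─ e)) (punchIn (v e) a) (punchIn (v e) b)
      ≡⟨ parity-edges (G ─ e) _ _ ⟩
    adj (G ─ e) (punchIn (v e) a) (punchIn (v e) b)
      ≡⟨ adj-─-away _ pb≢u (Fin.punchInᵢ≢i (v e) b) ⟩
    adj G (punchIn (v e) a) (punchIn (v e) b)
      ∎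
    where
    open ≡-Reasoning
    unmerge : ∀ p → links (mapPair merge p) a b ≡ links p (punchIn (v e) a) (punchIn (v e) b)
    unmerge (y , z) rewrite merge-==-unmerged a y pa≢u | merge-==-unmerged a z pa≢u
                          | merge-==-unmerged b y pb≢u | merge-==-unmerged b z pb≢u = refl

  contraction-parity : SameParity contracted (edges (G Δ e))
  contraction-parity a b = trans (parity-contracted a b) (sym (parity-edges (G Δ e) a b))
    where
    parity-contracted : ∀ a b → parity contracted a b ≡ Δadj G e a b
    parity-contracted a b with a Fin.≟ b
    ... | yes refl = trans (parity-diagonal contracted-loopFree a) (sym (Δadj-irrefl G e a))
    ... | no a≢b with punchIn (v e) a Fin.≟ u e | punchIn (v e) b Fin.≟ u e
    ...   | yes pa≡u | yes pb≡u = ⊥-elim (a≢b (Fin.punchIn-injective (v e) a b (trans pa≡u (sym pb≡u))))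
    ...   | yes pa≡u | no pb≢u  = parity-contracted-merged a b pa≡u pb≢u
    ...   | no pa≢u  | yes pb≡u =
      trans (xorˡ-cong (λ p → links-sym p a b) contracted) (parity-contracted-merged b a pb≡u pa≢u)
    ...   | no pa≢u  | no pb≢u  = parity-contracted-unmerged a b pa≢u pb≢u

  Z-deletion-contraction : ∀ q r → r ℚ.+ (r ℚ.+ r ℚ.* r) ≡ 0ℚ →
                           Z G q r ≡ Z (G ─ e) q r ℚ.+ r ℚ.* Z (G Δ e) q r
  Z-deletion-contraction q r 2r+r²≡0 = begin
    Z G q r
      ≡⟨ E⁺.Z≡Zwith (edges G) ⟩
    E⁺.Zwith (edges G) []
      ≡⟨ P⁺.Zwith-parity _ (edges G) ((u e , v e) ∷ edges (G ─ e)) ℕ.≤-refl deletion-parity [] ⟩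
    E⁺.Zwith (edges (G ─ e)) [] +r· E⁺.Zwith (edges (G ─ e)) ((u e , v e) ∷ [])
      ≡⟨ cong₂ _+r·_ (sym (E⁺.Z≡Zwith (edges (G ─ e))))
                     (Zwith-contract (u e) (v e) v≢u q r (edges (G ─ e)) []) ⟩
    Z (G ─ e) q r +r· E⁻.Zwith contracted []
      ≡⟨ cong (Z (G ─ e) q r +r·_)
              (P⁻.Zwith-parity _ contracted (edges (G Δ e)) ℕ.≤-refl contraction-parity []) ⟩
    Z (G ─ e) q r +r· E⁻.Zwith (edges (G Δ e)) []
      ≡⟨ cong (Z (G ─ e) q r +r·_) (sym (E⁻.Z≡Zwith (edges (G Δ e)))) ⟩
    Z (G ─ e) q r +r· Z (G Δ e) q r
      ∎
    where
    open ≡-Reasoning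
    module E⁺ = Expansion {suc m} q r
    module E⁻ = Expansion {m} q r
    module P⁺ = ParityInvariance {suc m} q r 2r+r²≡0
    module P⁻ = ParityInvariance {m} q r 2r+r²≡0
    open E⁺ using (_+r·_)

  P-deletion-contraction : ∀ x → P G x ≡ P (G ─ e) x - P (G Δ e) x
  P-deletion-contraction x = begin
    (half ℚ.* H) ℚ.* Z G q (- two)
      ≡⟨ cong ((half ℚ.* H) ℚ.*_) (Z-deletion-contraction q (- two) -2+4≡0) ⟩
    (half ℚ.* H) ℚ.* (Z₁ ℚ.+ (- two) ℚ.* Z₂)
      ≡⟨ solve 5 (λ h H z₁ z₂ r → (h :* H) :* (z₁ :+ r :* z₂) := (h :* H) :* z₁ :+ (h :* r) :* (H :* z₂))
               refl half H Z₁ Z₂ (- two) ⟩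
    (half ℚ.* H) ℚ.* Z₁ ℚ.+ (half ℚ.* (- two)) ℚ.* (H ℚ.* Z₂)
      ≡⟨ cong (λ c → (half ℚ.* H) ℚ.* Z₁ ℚ.+ c ℚ.* (H ℚ.* Z₂)) half·-2≡-1 ⟩
    (half ℚ.* H) ℚ.* Z₁ ℚ.+ (- 1ℚ) ℚ.* (H ℚ.* Z₂)
      ≡⟨ cong ((half ℚ.* H) ℚ.* Z₁ ℚ.+_)
              (trans (sym (ℚ.neg-distribˡ-* 1ℚ (H ℚ.* Z₂))) (cong -_ (ℚ.*-identityˡ (H ℚ.* Z₂)))) ⟩
    P (G ─ e) x - P (G Δ e) x
      ∎
    where
    open ≡-Reasoning
    open +-*-Solver using (solve; _:+_; _:*_; _:=_)
    q = two ℚ.* x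
    H = half ^ℚ m
    Z₁ = Z (G ─ e) q (- two)
    Z₂ = Z (G Δ e) q (- two)
    -2+4≡0 : - two ℚ.+ (- two ℚ.+ - two ℚ.* - two) ≡ 0ℚ
    -2+4≡0 = refl
    half·-2≡-1 : half ℚ.* (- two) ≡ - 1ℚ
    half·-2≡-1 = refl

pow-* : ∀ a b n → (a ℚ.* b) ^ℚ n ≡ (a ^ℚ n) ℚ.* (b ^ℚ n)
pow-* a b zero    = refl
pow-* a b (suc n) =
  trans (cong ((a ℚ.* b) ℚ.*_) (pow-* a b n))
        (solve 4 (λ a b A B → (a :* b) :* (A :* B) := (a :* A) :* (b :* B)) refl a b (a ^ℚ n) (b ^ℚ n))
  where open +-*-Solver using (solve; _:*_; _:=_)

Z-edgeless : ∀ n q r → Z (edgeless n) q r ≡ q ^ℚ n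
Z-edgeless n q r = begin
  Z (edgeless n) q r             ≡⟨ cong (λ E → sumℚ (map term (subsets E))) no-edges ⟩
  (q ^ℚ k {n} []) ℚ.* 1ℚ ℚ.+ 0ℚ  ≡⟨ trans (ℚ.+-identityʳ _) (ℚ.*-identityʳ _) ⟩
  q ^ℚ k {n} []                  ≡⟨ cong (q ^ℚ_) (k-[] n) ⟩
  q ^ℚ n                         ∎
  where
  open ≡-Reasoning
  term : List (Pair n) → ℚ
  term A = (q ^ℚ k A) ℚ.* (r ^ℚ length A)
  no-edges : edges (edgeless n) ≡ []
  no-edges = filter-none (T? ∘ λ _ → false) (All.universal (λ _ ()) (pairs n))

P-edgeless : ∀ n x → P (edgeless n) x ≡ x ^ℚ n
P-edgeless n x = begin
  (half ^ℚ n) ℚ.* Z (edgeless n) (two ℚ.* x) (- two)  ≡⟨ cong ((half ^ℚ n) ℚ.*_) (Z-edgeless n (two ℚ.* x) (- two)) ⟩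
  (half ^ℚ n) ℚ.* ((two ℚ.* x) ^ℚ n)                  ≡⟨ sym (pow-* half (two ℚ.* x) n) ⟩
  (half ℚ.* (two ℚ.* x)) ^ℚ n                         ≡⟨ cong (_^ℚ n) (sym (ℚ.*-assoc half two x)) ⟩
  (half ℚ.* two ℚ.* x) ^ℚ n                           ≡⟨ cong (λ c → (c ℚ.* x) ^ℚ n) half·2≡1 ⟩
  (1ℚ ℚ.* x) ^ℚ n                                     ≡⟨ cong (_^ℚ n) (ℚ.*-identityˡ x) ⟩
  x ^ℚ n                                              ∎
  where
  open ≡-Reasoning
  half·2≡1 : half ℚ.* two ≡ 1ℚ
  half·2≡1 = refl

-- The identity for edgeless graphs holds for n = 0 as well.
theorem2p1 : ((m : ℕ) (G : Graph (suc m)) (e : Edge G) (x : ℚ) →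
    P G x ≡ P (G ─ e) x - P (G Δ e) x)
    ×
    ((n : ℕ) → 1 ≤ n → (x : ℚ) → P (edgeless n) x ≡ x ^ℚ n)
theorem2p1 = (λ m G e → DeletionContraction.P-deletion-contraction G e)
           , (λ n _ → P-edgeless n)
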